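{- Let $D_n=\langle a,b\mid a^n=b^2=1,\ bab=a^{ -1}\rangle$ and let $\mathcal{M}=CM(D_n,X,p)$ be a Cayley map for $D_n$ of valency $|X|=3$. Then $\mathcal{M}$ is reflexible regular if and only if $\mathcal{M}$ is isomorphic to $CM(D_2,\{b,ab,a\},(b,ab,a))$, to $CM(D_3,\{b,ab,a^2b\},(b,ab,a^2b))$, or to $CM(D_4,\{b,a,a^{ -1}\},(b,a,a^{ -1}))$.
   Context: For a finite group $G$ and a generating set $X\subseteq G\setminus\{1_G\}$ with $X=X^{ -1}$, and a cyclic permutation $p$ of $X$, the Cayley map $CM(G,X,p)$ is the embedding of the Cayley graph $C(G,X)$ (vertices $G$, $g\sim gx$ for $x\in X$) into an orientable surface in which the cyclic order of edges $\{g,gx\}$ around each vertex $g$ is given by $p$. It is regular if its group of orientation-preserving map automorphisms acts transitively on arcs, and reflexible if in addition it has an orientation-reversing map automorphism. Isomorphism means isomorphism of maps. -}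

module Defs where

open import Data.Nat using (ℕ; zero; suc; _+_; _∸_; NonZero)
open import Data.Nat.DivMod using (_mod_)
open import Data.Fin using (Fin; toℕ) renaming (zero to f0; suc to fs)
open import Data.Bool using (Bool; true; false; not)
open import Data.Product using (_×_; _,_; ∃; Σ)
open import Data.Sum using (_⊎_)
open import Data.List using (List; foldr)
import Data.List
open import Data.List.Relation.Unary.All using (All)
open import Relation.Binary.PropositionalEquality using (_≡_; _≢_)
open import Function.Bundles using (_⤖_; Bijection)

-- The dihedral group D_n = ⟨ a , b | a^n = b^2 = 1 , bab = a^{-1} ⟩,
-- concretely: the element a^i b^e is encoded as (i , e) with
-- i : Fin n (exponent mod n) and e : Bool (false = b^0, true = b^1).

Dih : ℕ → Set
Dih n = Fin n × Bool

module _ {n : ℕ} .{{_ : NonZero n}} where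

  _⊕_ : Fin n → Fin n → Fin n
  i ⊕ j = (toℕ i + toℕ j) mod n

  ⊖_ : Fin n → Fin n
  ⊖ j = (n ∸ toℕ j) mod n

  one : Dih n
  one = (0 mod n , false)

  -- (a^i b^e)(a^j b^f) = a^(i ± j) b^(e+f), using b a^j = a^(-j) b
  _·_ : Dih n → Dih n → Dih n
  (i , false) · (j , f) = (i ⊕ j , f)
  (i , true)  · (j , f) = (i ⊕ (⊖ j) , not f)

  inv : Dih n → Dih n
  inv (i , false) = (⊖ i , false)
  inv (i , true)  = (i , true)

  gen-a : Dih n
  gen-a = (1 mod n , false)

  gen-b : Dih n
  gen-b = (0 mod n , true)

  a^_ : ℕ → Dih n
  a^ k = (k mod n , false)

  a^_b : ℕ → Dih n
  a^ k b = (k mod n , true)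

  product : List (Dih n) → Dih n
  product = foldr _·_ one

-- A 3-element set X = {x 0, x 1, x 2} together with a cyclic permutation
-- p of X is encoded by an injective triple x : Fin 3 → D_n with
-- p (x k) = x (k + 1 mod 3).  Every valency-3 (X , p) arises this way.

next : Fin 3 → Fin 3
next f0 = fs f0
next (fs f0) = fs (fs f0)
next (fs (fs f0)) = f0

record IsCayley3 (n : ℕ) .{{_ : NonZero n}} (x : Fin 3 → Dih n) : Set where
  field
    distinct  : ∀ i j → x i ≡ x j → i ≡ j
    nonId     : ∀ i → x i ≢ one
    invClosed : ∀ i → ∃ λ j → x j ≡ inv (x i)
    generates : ∀ (g : Dih n) → ∃ λ (ws : List (Fin 3)) →
                  product (Data.List.map x ws) ≡ g

-- Darts (arcs) of CM(D_n, X, p): pairs (g , k) standing for the arc from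
-- g to g·x_k.
Dart : ℕ → Set
Dart n = Dih n × Fin 3

rot : {n : ℕ} → Dart n → Dart n
rot (g , k) = (g , next k)

Lrel : (n : ℕ) .{{_ : NonZero n}} (x : Fin 3 → Dih n) → Dart n → Dart n → Set
Lrel n x (g , k) (h , k') = (h ≡ g · x k) × (x k' ≡ inv (x k))

record MapIso (n : ℕ) .{{_ : NonZero n}} (x : Fin 3 → Dih n)
              (m : ℕ) .{{_ : NonZero m}} (y : Fin 3 → Dih m) : Set where
  field
    φ      : Dart n ⤖ Dart m
    φ-rot  : ∀ d → Bijection.to φ (rot d) ≡ rot (Bijection.to φ d)
    φ-L    : ∀ d d' → Lrel n x d d' → Lrel m y (Bijection.to φ d) (Bijection.to φ d')

Aut⁺ : (n : ℕ) .{{_ : NonZero n}} (x : Fin 3 → Dih n) → Set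
Aut⁺ n x = MapIso n x n x

-- Orientation-reversing map automorphism: ψ R = R⁻¹ ψ, ψ L = L ψ
record AutRev (n : ℕ) .{{_ : NonZero n}} (x : Fin 3 → Dih n) : Set where
  field
    ψ      : Dart n ⤖ Dart n
    ψ-rot  : ∀ d → rot (Bijection.to ψ (rot d)) ≡ Bijection.to ψ d
    ψ-L    : ∀ d d' → Lrel n x d d' → Lrel n x (Bijection.to ψ d) (Bijection.to ψ d')

Regular : (n : ℕ) .{{_ : NonZero n}} (x : Fin 3 → Dih n) → Set
Regular n x = ∀ (d d' : Dart n) → Σ (Aut⁺ n x) λ α →
                Bijection.to (MapIso.φ α) d ≡ d'

ReflexibleRegular : (n : ℕ) .{{_ : NonZero n}} (x : Fin 3 → Dih n) → Set
ReflexibleRegular n x = Regular n x × AutRev n x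

triple : {A : Set} → A → A → A → Fin 3 → A
triple u v w f0 = u
triple u v w (fs f0) = v
triple u v w (fs (fs f0)) = w

x-D2 : Fin 3 → Dih 2
x-D2 = triple gen-b (a^ 1 b) gen-a

x-D3 : Fin 3 → Dih 3
x-D3 = triple gen-b (a^ 1 b) (a^ 2 b)

x-D4 : Fin 3 → Dih 4
x-D4 = triple gen-b gen-a (inv gen-a)

-- Lift D_n to the infinite dihedral group ℤ ⋊ C₂, so that relations in D_n become congruences modulo n.
-- In a regular map a walk composed of the face steps F = RL and G = R⁻¹L commutes with every automorphism,
-- so it fixes all darts once it fixes one, and an orientation-reversing automorphism turns F into G.
-- Some generator is a reflection, as X generates D_n. With exactly two reflections, (GF)² fixes a dart at 1,
-- hence all of them, and n ∣ 2; with exactly one, the two rotations are involutions or F⁴ fixes every dart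
-- at 1, and n ∣ 4. With three reflections a^{eᵢ} b put u = e₀ − e₁ and v = e₀ − e₂: the walk (FG)^q (GF)^p
-- with p ≡ v, q ≡ −u fixes (1 , x₀), so it and its mirror image fix every dart at 1, giving quadratic relations
-- in u, v that force n ∣ 3. For n ∈ {2, 3, 4} an automorphism a ↦ a^s, b ↦ a^t b found by finite search
-- identifies the map with an exceptional one, and the exceptional maps are reflexible regular by a rotation
-- and a reflection about 1 that are checked by computation.

module Submission where

open import Defs
open import Data.Nat as ℕ using (ℕ; zero; suc; NonZero; _∸_)
import Data.Nat.Properties as ℕ
import Data.Nat.Divisibility as ℕ
open import Data.Nat.DivMod using (_mod_; _%_; _/_; m≡m%n+[m/n]*n; m<n⇒m%n≡m)
open import Data.Integer as ℤ using (ℤ; +_; _+_; _*_; _-_; -_; 0ℤ; 1ℤ)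
import Data.Integer.Properties as ℤ
open import Data.Integer.Divisibility.Signed using (_∣_; divides; ∣⇒∣ᵤ; ∣-refl; ∣m∣n⇒∣m+n; ∣m⇒∣-m; ∣n⇒∣m*n)
open import Data.Integer.DivMod using (_%ℕ_; _/ℕ_; a≡a%ℕn+[a/ℕn]*n)
open import Data.Integer.Tactic.RingSolver using (solve-∀; solve)
open import Data.Fin as Fin using (Fin; toℕ) renaming (zero to f0; suc to fs)
import Data.Fin.Properties as Fin
open import Data.Bool using (Bool; true; false; not)
import Data.Bool.Properties as Bool
open import Data.List as List using ([]; _∷_)
open import Data.Product using (_×_; _,_; ∃; Σ; proj₁; proj₂)
open import Data.Sum using (_⊎_; inj₁; inj₂)
open import Data.Nat.GeneralisedArithmetic using (iterate)
open import Function.Bundles using (Bijection; Inverse; _⇔_; mk⇔; mk↔ₛ′)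
open import Function.Properties.Bijection using (⤖⇒↔)
open import Function.Properties.Inverse using (↔⇒⤖)
open import Relation.Binary.PropositionalEquality
open import Relation.Binary.Bundles using (Setoid)
open import Relation.Nullary using (¬_; Dec)
open import Relation.Nullary.Decidable using (from-yes; from-no; map′; _×-dec_; _→-dec_; ¬?)
open import Relation.Binary.Definitions using (DecidableEquality)
open import Data.Product.Properties using (≡-dec)
open import Data.Empty using (⊥-elim)
import Relation.Binary.Reasoning.Setoid as SetoidReasoning

module Congruence (n : ℕ) .{{_ : NonZero n}} where

  infix 4 _≋_
  record _≋_ (a b : ℤ) : Set where
    constructor mk≋
    field n∣a-b : + n ∣ a - b

  ∣-by : ∀ {a b} → + n ∣ a → a ≡ b → + n ∣ b
  ∣-by d refl = d

  n∣0 : + n ∣ 0ℤ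
  n∣0 = divides 0ℤ refl

  ≋-refl : ∀ {a} → a ≋ a
  ≋-refl {a} = mk≋ (∣-by n∣0 (sym (ℤ.+-inverseʳ a)))

  ≋-reflexive : ∀ {a b} → a ≡ b → a ≋ b
  ≋-reflexive refl = ≋-refl

  ≋-sym : ∀ {a b} → a ≋ b → b ≋ a
  ≋-sym {a} {b} (mk≋ d) = mk≋ (∣-by (∣m⇒∣-m d) (solve (a ∷ b ∷ [])))

  ≋-trans : ∀ {a b c} → a ≋ b → b ≋ c → a ≋ c
  ≋-trans {a} {b} {c} (mk≋ d) (mk≋ e) = mk≋ (∣-by (∣m∣n⇒∣m+n d e) (solve (a ∷ b ∷ c ∷ [])))

  ≋-setoid : Setoid _ _
  ≋-setoid = record { Carrier = ℤ ; _≈_ = _≋_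
    ; isEquivalence = record { refl = ≋-refl ; sym = ≋-sym ; trans = ≋-trans } }

  +-cong : ∀ {a a′ b b′} → a ≋ a′ → b ≋ b′ → a + b ≋ a′ + b′
  +-cong {a} {a′} {b} {b′} (mk≋ d) (mk≋ e) = mk≋ (∣-by (∣m∣n⇒∣m+n d e) (solve (a ∷ a′ ∷ b ∷ b′ ∷ [])))

  neg-cong : ∀ {a a′} → a ≋ a′ → - a ≋ - a′
  neg-cong {a} {a′} (mk≋ d) = mk≋ (∣-by (∣m⇒∣-m d) (solve (a ∷ a′ ∷ [])))

  *-congˡ : ∀ c {a a′} → a ≋ a′ → c * a ≋ c * a′
  *-congˡ c {a} {a′} (mk≋ d) = mk≋ (∣-by (∣n⇒∣m*n c d) (solve (c ∷ a ∷ a′ ∷ [])))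

  *-congʳ : ∀ c {a a′} → a ≋ a′ → a * c ≋ a′ * c
  *-congʳ c {a} {a′} (mk≋ d) = mk≋ (∣-by (∣n⇒∣m*n c d) (solve (c ∷ a ∷ a′ ∷ [])))

  ∣-lincomb : ∀ {a b} → + n ∣ a → + n ∣ b → ∀ s t → + n ∣ s * a + t * b
  ∣-lincomb n∣a n∣b s t = ∣m∣n⇒∣m+n (∣n⇒∣m*n s n∣a) (∣n⇒∣m*n t n∣b)

  n≋0 : + n ≋ 0ℤ
  n≋0 = mk≋ (∣-by ∣-refl (sym (ℤ.+-identityʳ (+ n))))

  ≋0⇒∣ : ∀ {a} → a ≋ 0ℤ → + n ∣ a
  ≋0⇒∣ {a} (mk≋ d) = ∣-by d (ℤ.+-identityʳ a)

  ≋-representative : ∀ a → ∃ λ p → + p ≋ a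
  ≋-representative a = a %ℕ n , mk≋ (∣-by (∣m⇒∣-m (divides (a /ℕ n) refl)) (begin
    - (q * + n)         ≡⟨ identity r q (+ n) ⟩
    r - (r + q * + n)   ≡⟨ cong (λ b → r - b) (a≡a%ℕn+[a/ℕn]*n a n) ⟨
    r - a               ∎))
    where
    open ≡-Reasoning
    r = + (a %ℕ n)
    q = a /ℕ n
    identity : ∀ r q m → - (q * m) ≡ r - (r + q * m)
    identity = solve-∀

  private
    ≋-ordered⇒≡ : ∀ {a b} → a ℕ.≤ b → b ℕ.< n → + a ≋ + b → a ≡ b
    ≋-ordered⇒≡ {a} {b} a≤b b<n (mk≋ d) = ℕ.≤-antisym a≤b (ℕ.m∸n≡0⇒m≤n b∸a≡0)
      where
      n∣b∸a : n ℕ.∣ b ∸ a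
      n∣b∸a = subst (n ℕ.∣_) (trans (cong ℤ.∣_∣ (ℤ.m-n≡m⊖n a b)) (ℤ.∣⊖∣-≤ a≤b)) (∣⇒∣ᵤ d)
      b∸a≡0 : b ∸ a ≡ 0
      b∸a≡0 = trans (sym (m<n⇒m%n≡m (ℕ.≤-<-trans (ℕ.m∸n≤m b a) b<n))) (ℕ.n∣m⇒m%n≡0 _ n n∣b∸a)

  ≋-small⇒≡ : ∀ {a b} → a ℕ.< n → b ℕ.< n → + a ≋ + b → a ≡ b
  ≋-small⇒≡ {a} {b} a<n b<n a≋b with ℕ.≤-total a b
  ... | inj₁ a≤b = ≋-ordered⇒≡ a≤b b<n a≋b
  ... | inj₂ b≤a = sym (≋-ordered⇒≡ b≤a a<n (≋-sym a≋b))

  ⟦_⟧ : Fin n → ℤ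
  ⟦ i ⟧ = + toℕ i

  ⟦⟧-injective : ∀ {i j} → ⟦ i ⟧ ≋ ⟦ j ⟧ → i ≡ j
  ⟦⟧-injective {i} {j} e = Fin.toℕ-injective (≋-small⇒≡ (Fin.toℕ<n i) (Fin.toℕ<n j) e)

  ⟦mod⟧ : ∀ m → ⟦ m mod n ⟧ ≋ + m
  ⟦mod⟧ m = mk≋ (∣-by (∣m⇒∣-m (divides (+ (m / n)) refl)) (begin
    - (q * + n)                ≡⟨ identity (+ (m % n)) q (+ n) ⟩
    + (m % n) - (+ (m % n) + q * + n)  ≡⟨ cong₂ (λ r s → + r - s) (sym (Fin.toℕ-fromℕ< _)) (sym m≡r+q*n) ⟩
    ⟦ m mod n ⟧ - + m          ∎))
    where
    open ≡-Reasoning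
    q = + (m / n)
    identity : ∀ r q m → - (q * m) ≡ r - (r + q * m)
    identity = solve-∀
    m≡r+q*n : + m ≡ + (m % n) + q * + n
    m≡r+q*n = trans (cong +_ (m≡m%n+[m/n]*n m n)) (trans (ℤ.pos-+ (m % n) _) (cong (λ t → + (m % n) + t) (ℤ.pos-* (m / n) n)))

  ⟦⊕⟧ : ∀ i j → ⟦ i ⊕ j ⟧ ≋ ⟦ i ⟧ + ⟦ j ⟧
  ⟦⊕⟧ i j = ≋-trans (⟦mod⟧ (toℕ i ℕ.+ toℕ j)) (≋-reflexive (ℤ.pos-+ (toℕ i) (toℕ j)))

  ⟦⊖⟧ : ∀ j → ⟦ ⊖ j ⟧ ≋ - ⟦ j ⟧
  ⟦⊖⟧ j = begin
    ⟦ ⊖ j ⟧            ≈⟨ ⟦mod⟧ (n ∸ toℕ j) ⟩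
    + (n ∸ toℕ j)      ≡⟨ sym (ℤ.⊖-≥ (ℕ.<⇒≤ (Fin.toℕ<n j))) ⟩
    n ℤ.⊖ toℕ j        ≡⟨ sym (ℤ.m-n≡m⊖n n (toℕ j)) ⟩
    + n - ⟦ j ⟧        ≈⟨ +-cong n≋0 (≋-refl { - ⟦ j ⟧}) ⟩
    0ℤ - ⟦ j ⟧         ≡⟨ ℤ.+-identityˡ _ ⟩
    - ⟦ j ⟧            ∎
    where open SetoidReasoning ≋-setoid

  -- The first hypothesis says that u and v generate ℤ/n.
  quadratic-relations⇒∣3 : ∀ u v → (∀ c → + n ∣ c * u → + n ∣ c * v → + n ∣ c) →
    + n ∣ v * (v - u) + u * u → + n ∣ u * u - + 2 * (u * v) → + n ∣ + 2 * (u * v) - v * v → + n ∣ + 3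
  quadratic-relations⇒∣3 u v generate D F₁ F₂ = generate (+ 3) 3u (∣-by (∣-lincomb S 3u (+ 3) (- 1ℤ)) (id₅ u v))
    where
    S : + n ∣ u + v
    S = generate (u + v) (∣-by (∣-lincomb D F₂ 1ℤ 1ℤ) (id₁ u v)) (∣-by (∣-lincomb D F₁ 1ℤ (- 1ℤ)) (id₂ u v))
      where
      id₁ : ∀ u v → 1ℤ * (v * (v - u) + u * u) + 1ℤ * (+ 2 * (u * v) - v * v) ≡ (u + v) * u
      id₁ = solve-∀
      id₂ : ∀ u v → 1ℤ * (v * (v - u) + u * u) + - 1ℤ * (u * u - + 2 * (u * v)) ≡ (u + v) * v
      id₂ = solve-∀
    3u : + n ∣ + 3 * u
    3u = generate (+ 3 * u) (∣-by (∣-lincomb F₁ S 1ℤ (+ 2 * u)) (id₃ u v)) (∣-by (∣-lincomb S F₁ u (- 1ℤ)) (id₄ u v))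
      where
      id₃ : ∀ u v → 1ℤ * (u * u - + 2 * (u * v)) + (+ 2 * u) * (u + v) ≡ (+ 3 * u) * u
      id₃ = solve-∀
      id₄ : ∀ u v → u * (u + v) + - 1ℤ * (u * u - + 2 * (u * v)) ≡ (+ 3 * u) * v
      id₄ = solve-∀
    id₅ : ∀ u v → + 3 * (u + v) + - 1ℤ * (+ 3 * u) ≡ + 3 * v
    id₅ = solve-∀

-- The infinite dihedral group ℤ ⋊ C₂, in which (A , false) is a^A and (A , true) is a^A b
D∞ : Set
D∞ = ℤ × Bool

infixl 7 _⋆_
_⋆_ : D∞ → D∞ → D∞
(A , false) ⋆ (B , f) = (A + B , f)
(A , true)  ⋆ (B , f) = (A - B , not f)

inv∞ : D∞ → D∞
inv∞ (A , false) = (- A , false)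
inv∞ (A , true)  = (A , true)

⋆-assoc : ∀ P Q R → (P ⋆ Q) ⋆ R ≡ P ⋆ (Q ⋆ R)
⋆-assoc (A , false) (B , false) (C , f) = cong (_, f) (ℤ.+-assoc A B C)
⋆-assoc (A , false) (B , true)  (C , f) = cong (_, not f) (ℤ.+-assoc A B (- C))
⋆-assoc (A , true)  (B , false) (C , f) = cong (_, not f) (identity A B C)
  where
  identity : ∀ A B C → A - B - C ≡ A - (B + C)
  identity = solve-∀
⋆-assoc (A , true)  (B , true)  (C , f) = cong₂ _,_ (identity A B C) (sym (Bool.not-involutive f))
  where
  identity : ∀ A B C → A - B + C ≡ A - (B - C)
  identity = solve-∀

⋆-identityˡ : ∀ P → (0ℤ , false) ⋆ P ≡ P
⋆-identityˡ (A , e) = cong (_, e) (ℤ.+-identityˡ A)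

⋆-identityʳ : ∀ P → P ⋆ (0ℤ , false) ≡ P
⋆-identityʳ (A , false) = cong (_, false) (ℤ.+-identityʳ A)
⋆-identityʳ (A , true)  = cong (_, true) (ℤ.+-identityʳ A)

inv∞-inverseˡ : ∀ P → inv∞ P ⋆ P ≡ (0ℤ , false)
inv∞-inverseˡ (A , false) = cong (_, false) (ℤ.+-inverseˡ A)
inv∞-inverseˡ (A , true)  = cong (_, false) (ℤ.+-inverseʳ A)

inv∞-involutive : ∀ P → inv∞ (inv∞ P) ≡ P
inv∞-involutive (A , false) = cong (_, false) (ℤ.neg-involutive A)
inv∞-involutive (A , true)  = refl

module Reduction (n : ℕ) .{{_ : NonZero n}} where
  open Congruence n

  lift : Dih n → D∞
  lift (i , e) = (⟦ i ⟧ , e)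

  infix 4 _≈_
  record _≈_ (P Q : D∞) : Set where
    constructor _,_
    field
      flag     : proj₂ P ≡ proj₂ Q
      exponent : proj₁ P ≋ proj₁ Q

  ≈-reflexive : ∀ {P Q} → P ≡ Q → P ≈ Q
  ≈-reflexive refl = refl , ≋-refl

  ≈-refl : ∀ {P} → P ≈ P
  ≈-refl = ≈-reflexive refl

  ≈-sym : ∀ {P Q} → P ≈ Q → Q ≈ P
  ≈-sym (e , a) = sym e , ≋-sym a

  ≈-trans : ∀ {P Q R} → P ≈ Q → Q ≈ R → P ≈ R
  ≈-trans (e , a) (f , b) = trans e f , ≋-trans a b

  ≈-setoid : Setoid _ _
  ≈-setoid = record { Carrier = D∞ ; _≈_ = _≈_
    ; isEquivalence = record { refl = ≈-refl ; sym = ≈-sym ; trans = ≈-trans } }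

  ⋆-cong : ∀ {P P′ Q Q′} → P ≈ P′ → Q ≈ Q′ → P ⋆ Q ≈ P′ ⋆ Q′
  ⋆-cong {_ , false} {_ , .false} (refl , a) (f , b) = f , +-cong a b
  ⋆-cong {_ , true}  {_ , .true}  (refl , a) (f , b) = cong not f , +-cong a (neg-cong b)

  inv∞-cong : ∀ {P P′} → P ≈ P′ → inv∞ P ≈ inv∞ P′
  inv∞-cong {_ , false} {_ , .false} (refl , a) = refl , neg-cong a
  inv∞-cong {_ , true}  {_ , .true}  (refl , a) = refl , a

  lift-injective : ∀ {g h} → lift g ≈ lift h → g ≡ h
  lift-injective {_ , e} {_ , .e} (refl , a) = cong (_, e) (⟦⟧-injective a)

  lift-one : lift one ≈ (0ℤ , false)
  lift-one = refl , ⟦mod⟧ 0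

  lift-· : ∀ g h → lift (g · h) ≈ lift g ⋆ lift h
  lift-· (i , false) (j , f) = refl , ⟦⊕⟧ i j
  lift-· (i , true)  (j , f) = refl , ≋-trans (⟦⊕⟧ i (⊖ j)) (+-cong (≋-refl {⟦ i ⟧}) (⟦⊖⟧ j))

  lift-inv : ∀ g → lift (inv g) ≈ inv∞ (lift g)
  lift-inv (i , false) = refl , ⟦⊖⟧ i
  lift-inv (i , true)  = refl , ≋-refl

  open SetoidReasoning ≈-setoid

  ·-assoc : ∀ g h k → (g · h) · k ≡ g · (h · k)
  ·-assoc g h k = lift-injective (begin
    lift ((g · h) · k)          ≈⟨ lift-· (g · h) k ⟩
    lift (g · h) ⋆ lift k       ≈⟨ ⋆-cong (lift-· g h) (≈-refl {lift k}) ⟩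
    lift g ⋆ lift h ⋆ lift k    ≡⟨ ⋆-assoc (lift g) (lift h) (lift k) ⟩
    lift g ⋆ (lift h ⋆ lift k)  ≈⟨ ⋆-cong (≈-refl {lift g}) (lift-· h k) ⟨
    lift g ⋆ lift (h · k)       ≈⟨ lift-· g (h · k) ⟨
    lift (g · (h · k))          ∎)

  ·-identityˡ : ∀ g → one · g ≡ g
  ·-identityˡ g = lift-injective (begin
    lift (one · g)              ≈⟨ lift-· one g ⟩
    lift one ⋆ lift g           ≈⟨ ⋆-cong lift-one (≈-refl {lift g}) ⟩
    (0ℤ , false) ⋆ lift g       ≡⟨ ⋆-identityˡ (lift g) ⟩
    lift g                      ∎)

  ·-identityʳ : ∀ g → g · one ≡ g
  ·-identityʳ g = lift-injective (begin
    lift (g · one)              ≈⟨ lift-· g one ⟩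
    lift g ⋆ lift one           ≈⟨ ⋆-cong (≈-refl {lift g}) lift-one ⟩
    lift g ⋆ (0ℤ , false)       ≡⟨ ⋆-identityʳ (lift g) ⟩
    lift g                      ∎)

  inv-inverseˡ : ∀ g → inv g · g ≡ one
  inv-inverseˡ g = lift-injective (begin
    lift (inv g · g)            ≈⟨ lift-· (inv g) g ⟩
    lift (inv g) ⋆ lift g       ≈⟨ ⋆-cong (lift-inv g) (≈-refl {lift g}) ⟩
    inv∞ (lift g) ⋆ lift g      ≡⟨ inv∞-inverseˡ (lift g) ⟩
    (0ℤ , false)                ≈⟨ lift-one ⟨
    lift one                    ∎)

  inv-involutive : ∀ g → inv (inv g) ≡ g
  inv-involutive g = lift-injective (begin
    lift (inv (inv g))          ≈⟨ lift-inv (inv g) ⟩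
    inv∞ (lift (inv g))         ≈⟨ inv∞-cong (lift-inv g) ⟩
    inv∞ (inv∞ (lift g))        ≡⟨ inv∞-involutive (lift g) ⟩
    lift g                      ∎)

  lift-·-≈ : ∀ {g h P Q} → lift g ≈ P → lift h ≈ Q → lift (g · h) ≈ P ⋆ Q
  lift-·-≈ {g} {h} g≈P h≈Q = ≈-trans (lift-· g h) (⋆-cong g≈P h≈Q)

  ≡one⇒≋0 : ∀ {g E} → g ≡ one → lift g ≈ (E , false) → E ≋ 0ℤ
  ≡one⇒≋0 refl (_ , e) = ≋-trans (≋-sym e) (_≈_.exponent lift-one)

  ≋0⇒≡one : ∀ {g E} → lift g ≈ (E , false) → E ≋ 0ℤ → g ≡ one
  ≋0⇒≡one g≈E E≋0 = lift-injective (≈-trans g≈E (≈-trans (refl , E≋0) (≈-sym lift-one)))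

  inv-inverseʳ : ∀ g → g · inv g ≡ one
  inv-inverseʳ g = subst (λ h → h · inv g ≡ one) (inv-involutive g) (inv-inverseˡ (inv g))

  rotation-reflection-square : ∀ {u v U V} → lift u ≈ (U , false) → lift v ≈ (V , true) →
                               (((one · u) · v) · u) · v ≡ one
  rotation-reflection-square {U = U} {V} u≈ v≈ =
    ≋0⇒≡one (lift-·-≈ (lift-·-≈ (lift-·-≈ (lift-·-≈ lift-one u≈) v≈) u≈) v≈) (≋-reflexive (identity U V))
    where
    identity : ∀ U V → 0ℤ + U + V - U - V ≡ 0ℤ
    identity = solve-∀

  reflection-rotation-square : ∀ {u v U V} → lift u ≈ (U , true) → lift v ≈ (V , false) →
                               (((one · u) · v) · u) · v ≡ one
  reflection-rotation-square {U = U} {V} u≈ v≈ =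
    ≋0⇒≡one (lift-·-≈ (lift-·-≈ (lift-·-≈ (lift-·-≈ lift-one u≈) v≈) u≈) v≈) (≋-reflexive (identity U V))
    where
    identity : ∀ U V → 0ℤ + U - V - U + V ≡ 0ℤ
    identity = solve-∀

  reflections-square : ∀ {u v U V} → lift u ≈ (U , true) → lift v ≈ (V , true) →
                       (((one · u) · v) · u) · v ≡ one → + n ∣ + 2 * (U - V)
  reflections-square {U = U} {V} u≈ v≈ [uv]²≡1 = ∣-by
    (≋0⇒∣ (≡one⇒≋0 [uv]²≡1 (lift-·-≈ (lift-·-≈ (lift-·-≈ (lift-·-≈ lift-one u≈) v≈) u≈) v≈)))
    (identity U V)
    where
    identity : ∀ U V → 0ℤ + U - V + U - V ≡ + 2 * (U - V)
    identity = solve-∀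

  rotation-fourth-power : ∀ {u U} → lift u ≈ (U , false) → (((one · u) · u) · u) · u ≡ one → + n ∣ + 4 * U
  rotation-fourth-power {U = U} u≈ u⁴≡1 = ∣-by
    (≋0⇒∣ (≡one⇒≋0 u⁴≡1 (lift-·-≈ (lift-·-≈ (lift-·-≈ (lift-·-≈ lift-one u≈) u≈) u≈) u≈)))
    (identity U)
    where
    identity : ∀ U → 0ℤ + U + U + U + U ≡ + 4 * U
    identity = solve-∀

  rotation-involution : ∀ {u U} → lift u ≈ (U , false) → u ≡ inv u → + n ∣ + 2 * U
  rotation-involution {u} {U} u≈ u≡u⁻¹ = ∣-by
    (≋0⇒∣ (≡one⇒≋0 (trans (cong (u ·_) u≡u⁻¹) (inv-inverseʳ u)) (lift-·-≈ u≈ u≈)))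
    (identity U)
    where
    identity : ∀ U → U + U ≡ + 2 * U
    identity = solve-∀

  lift-iterate-reflections : ∀ {u v g U V E} → lift u ≈ (U , true) → lift v ≈ (V , true) → lift g ≈ (E , false) →
                             ∀ p → lift (iterate (λ h → (h · u) · v) g p) ≈ (E + + p * (U - V) , false)
  lift-iterate-reflections {E = E} u≈ v≈ g≈ zero = ≈-trans g≈ (≈-reflexive (cong (_, false) (sym (ℤ.+-identityʳ E))))
  lift-iterate-reflections {u} {v} {g} {U} {V} {E} u≈ v≈ g≈ (suc p) =
    ≈-trans (lift-iterate-reflections u≈ v≈ (lift-·-≈ (lift-·-≈ g≈ u≈) v≈) p)
            (≈-reflexive (cong (_, false) (identity E U V (+ p))))
    where
    identity : ∀ E U V P → E + U - V + P * (U - V) ≡ E + (1ℤ + P) * (U - V)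
    identity = solve-∀

true≢false : true ≢ false
true≢false ()

inv-flag : ∀ {n} .{{_ : NonZero n}} (g : Dih n) → proj₂ (inv g) ≡ proj₂ g
inv-flag (i , false) = refl
inv-flag (i , true)  = refl

inv-reflection : ∀ {n} .{{_ : NonZero n}} (g : Dih n) → proj₂ g ≡ true → inv g ≡ g
inv-reflection (i , true) refl = refl

next³ : ∀ k → next (next (next k)) ≡ k
next³ f0           = refl
next³ (fs f0)      = refl
next³ (fs (fs f0)) = refl

next-orbit : ∀ k j → j ≡ k ⊎ j ≡ next k ⊎ j ≡ next (next k)
next-orbit f0           f0           = inj₁ refl
next-orbit f0           (fs f0)      = inj₂ (inj₁ refl)
next-orbit f0           (fs (fs f0)) = inj₂ (inj₂ refl)
next-orbit (fs f0)      f0           = inj₂ (inj₂ refl)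
next-orbit (fs f0)      (fs f0)      = inj₁ refl
next-orbit (fs f0)      (fs (fs f0)) = inj₂ (inj₁ refl)
next-orbit (fs (fs f0)) f0           = inj₂ (inj₁ refl)
next-orbit (fs (fs f0)) (fs f0)      = inj₂ (inj₂ refl)
next-orbit (fs (fs f0)) (fs (fs f0)) = inj₁ refl

next≢next² : ∀ k → next k ≢ next (next k)
next≢next² f0           ()
next≢next² (fs f0)      ()
next≢next² (fs (fs f0)) ()

rot³ : ∀ {n} (d : Dart n) → rot (rot (rot d)) ≡ d
rot³ (g , k) = cong (g ,_) (next³ k)

iterate-conj : ∀ {A B : Set} (h : A → B) {f : A → A} {f′ : B → B} → (∀ a → h (f a) ≡ f′ (h a)) →
               ∀ a p → h (iterate f a p) ≡ iterate f′ (h a) p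
iterate-conj h hf a zero    = refl
iterate-conj h {f} {f′} hf a (suc p) = trans (iterate-conj h hf (f a) p) (cong (λ b → iterate f′ b p) (hf a))

infixl 6 _+₃_
_+₃_ : Fin 3 → Fin 3 → Fin 3
k +₃ f0           = k
k +₃ fs f0        = next k
k +₃ fs (fs f0)   = next (next k)

-₃_ : Fin 3 → Fin 3
-₃ f0           = f0
-₃ fs f0        = fs (fs f0)
-₃ fs (fs f0)   = fs f0

+₃-next : ∀ k j → k +₃ next j ≡ next (k +₃ j)
+₃-next = from-yes (Fin.all? λ k → Fin.all? λ j → k +₃ next j Fin.≟ next (k +₃ j))

-₃-cancelˡ : ∀ k j → -₃ k +₃ (k +₃ j) ≡ j
-₃-cancelˡ = from-yes (Fin.all? λ k → Fin.all? λ j → -₃ k +₃ (k +₃ j) Fin.≟ j)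

-₃-cancelʳ : ∀ k j → k +₃ (-₃ k +₃ j) ≡ j
-₃-cancelʳ = from-yes (Fin.all? λ k → Fin.all? λ j → k +₃ (-₃ k +₃ j) Fin.≟ j)

-- Darts, face walks and map isomorphisms

module _ {n m : ℕ} .{{_ : NonZero n}} .{{_ : NonZero m}} {x : Fin 3 → Dih n} {y : Fin 3 → Dih m} where
  apply : MapIso n x m y → Dart n → Dart m
  apply α = Bijection.to (MapIso.φ α)

  unapply : MapIso n x m y → Dart m → Dart n
  unapply α = Inverse.from (⤖⇒↔ (MapIso.φ α))

  apply-unapply : ∀ α e → apply α (unapply α e) ≡ e
  apply-unapply α = Inverse.strictlyInverseˡ (⤖⇒↔ (MapIso.φ α))

  unapply-apply : ∀ α d → unapply α (apply α d) ≡ d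
  unapply-apply α = Inverse.strictlyInverseʳ (⤖⇒↔ (MapIso.φ α))

  mkMapIso : (f : Dart n → Dart m) (f⁻ : Dart m → Dart n) → (∀ e → f (f⁻ e) ≡ e) → (∀ d → f⁻ (f d) ≡ d) →
             (∀ d → f (rot d) ≡ rot (f d)) → (∀ d d′ → Lrel n x d d′ → Lrel m y (f d) (f d′)) → MapIso n x m y
  mkMapIso f f⁻ invˡ invʳ f-rot f-L = record { φ = ↔⇒⤖ (mk↔ₛ′ f f⁻ invˡ invʳ) ; φ-rot = f-rot ; φ-L = f-L }

module _ {m : ℕ} .{{_ : NonZero m}} {y : Fin 3 → Dih m} where
  applyRev : AutRev m y → Dart m → Dart m
  applyRev ψ = Bijection.to (AutRev.ψ ψ)

  unapplyRev : AutRev m y → Dart m → Dart m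
  unapplyRev ψ = Inverse.from (⤖⇒↔ (AutRev.ψ ψ))

  applyRev-unapplyRev : ∀ ψ e → applyRev ψ (unapplyRev ψ e) ≡ e
  applyRev-unapplyRev ψ = Inverse.strictlyInverseˡ (⤖⇒↔ (AutRev.ψ ψ))

  unapplyRev-applyRev : ∀ ψ d → unapplyRev ψ (applyRev ψ d) ≡ d
  unapplyRev-applyRev ψ = Inverse.strictlyInverseʳ (⤖⇒↔ (AutRev.ψ ψ))

  applyRev-rot : ∀ (ψ : AutRev m y) d → applyRev ψ (rot d) ≡ rot (rot (applyRev ψ d))
  applyRev-rot ψ d = trans (sym (rot³ _)) (cong (λ e → rot (rot e)) (AutRev.ψ-rot ψ d))

  mkAutRev : (f f⁻ : Dart m → Dart m) → (∀ e → f (f⁻ e) ≡ e) → (∀ d → f⁻ (f d) ≡ d) →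
             (∀ d → f (rot d) ≡ rot (rot (f d))) → (∀ d d′ → Lrel m y d d′ → Lrel m y (f d) (f d′)) → AutRev m y
  mkAutRev f f⁻ invˡ invʳ f-rot f-L = record
    { ψ = ↔⇒⤖ (mk↔ₛ′ f f⁻ invˡ invʳ) ; ψ-rot = λ d → trans (cong rot (f-rot d)) (rot³ (f d)) ; ψ-L = f-L }

module Darts {n : ℕ} .{{_ : NonZero n}} (x : Fin 3 → Dih n)
             (distinct : ∀ i j → x i ≡ x j → i ≡ j)
             (invClosed : ∀ i → ∃ λ j → x j ≡ inv (x i)) where

  ι : Fin 3 → Fin 3
  ι k = proj₁ (invClosed k)

  x-ι : ∀ k → x (ι k) ≡ inv (x k)
  x-ι k = proj₂ (invClosed k)

  L : Dart n → Dart n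
  L (g , k) = (g · x k , ι k)

  Lrel-L : ∀ d → Lrel n x d (L d)
  Lrel-L (g , k) = refl , x-ι k

  Lrel⇒≡L : ∀ {d d′} → Lrel n x d d′ → d′ ≡ L d
  Lrel⇒≡L {g , k} {h , k′} (h≡gx , xk′≡x⁻¹) = cong₂ _,_ h≡gx (distinct _ _ (trans xk′≡x⁻¹ (sym (x-ι k))))

  F G : Dart n → Dart n
  F d = rot (L d)
  G d = rot (rot (L d))

  Natural : (Dart n → Dart n) → Set
  Natural w = ∀ (α : Aut⁺ n x) d → apply α (w d) ≡ w (apply α d)

  L-natural : Natural L
  L-natural α d = Lrel⇒≡L (MapIso.φ-L α d (L d) (Lrel-L d))

  F-natural : Natural F
  F-natural α d = trans (MapIso.φ-rot α (L d)) (cong rot (L-natural α d))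

  G-natural : Natural G
  G-natural α d = trans (MapIso.φ-rot α (rot (L d))) (cong rot (F-natural α d))

  ∘-natural : ∀ {w w′} → Natural w → Natural w′ → Natural (λ d → w (w′ d))
  ∘-natural {w} {w′} nw nw′ α d = trans (nw α (w′ d)) (cong w (nw′ α d))

  iterate-natural : ∀ {w} → Natural w → ∀ p → Natural (λ d → iterate w d p)
  iterate-natural nw p α d = iterate-conj (apply α) (nw α) d p

  module _ (ψ : AutRev n x) where
    L-mirror : ∀ d → applyRev ψ (L d) ≡ L (applyRev ψ d)
    L-mirror d = Lrel⇒≡L (AutRev.ψ-L ψ d (L d) (Lrel-L d))

    F-mirror : ∀ d → applyRev ψ (F d) ≡ G (applyRev ψ d)
    F-mirror d = trans (applyRev-rot ψ (L d)) (cong (λ e → rot (rot e)) (L-mirror d))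

    G-mirror : ∀ d → applyRev ψ (G d) ≡ F (applyRev ψ d)
    G-mirror d = trans (applyRev-rot ψ (rot (L d))) (trans (cong (λ e → rot (rot e)) (F-mirror d)) (cong rot (rot³ _)))

  module _ (regular : Regular n x) where
    fixed-everywhere : ∀ {w} → Natural w → ∀ {d} → w d ≡ d → ∀ d′ → w d′ ≡ d′
    fixed-everywhere {w} nw {d} wd≡d d′ with regular d d′
    ... | α , αd≡d′ = begin
      w d′             ≡⟨ cong w αd≡d′ ⟨
      w (apply α d)    ≡⟨ nw α d ⟨
      apply α (w d)    ≡⟨ cong (apply α) wd≡d ⟩
      apply α d        ≡⟨ αd≡d′ ⟩
      d′               ∎
      where open ≡-Reasoning

    fixed-everywhere-mirrored : (ψ : AutRev n x) → ∀ {w w̄ : Dart n → Dart n} → Natural w̄ →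
      (∀ d → applyRev ψ (w d) ≡ w̄ (applyRev ψ d)) → ∀ {d} → w d ≡ d → ∀ d′ → w̄ d′ ≡ d′
    fixed-everywhere-mirrored ψ {w} {w̄} nw̄ ψw {d} wd≡d =
      fixed-everywhere {w̄} nw̄ {applyRev ψ d} (trans (sym (ψw d)) (cong (applyRev ψ) wd≡d))

module _ {n : ℕ} .{{_ : NonZero n}} {x : Fin 3 → Dih n} where
  iso-refl : MapIso n x n x
  iso-refl = mkMapIso (λ d → d) (λ d → d) (λ _ → refl) (λ _ → refl) (λ _ → refl) (λ _ _ r → r)

module _ {n m p : ℕ} .{{_ : NonZero n}} .{{_ : NonZero m}} .{{_ : NonZero p}}
         {x : Fin 3 → Dih n} {y : Fin 3 → Dih m} {z : Fin 3 → Dih p} where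
  iso-trans : MapIso n x m y → MapIso m y p z → MapIso n x p z
  iso-trans α β = mkMapIso (λ d → apply β (apply α d)) (λ e → unapply α (unapply β e))
    (λ e → trans (cong (apply β) (apply-unapply α (unapply β e))) (apply-unapply β e))
    (λ d → trans (cong (unapply α) (unapply-apply β (apply α d))) (unapply-apply α d))
    (λ d → trans (cong (apply β) (MapIso.φ-rot α d)) (MapIso.φ-rot β (apply α d)))
    (λ d d′ r → MapIso.φ-L β _ _ (MapIso.φ-L α d d′ r))

module _ {n m : ℕ} .{{_ : NonZero n}} .{{_ : NonZero m}} {x : Fin 3 → Dih n} {y : Fin 3 → Dih m} where
  iso-sym : (∀ i j → x i ≡ x j → i ≡ j) → (∀ i → ∃ λ j → x j ≡ inv (x i)) →
            (∀ i j → y i ≡ y j → i ≡ j) → (∀ i → ∃ λ j → y j ≡ inv (y i)) → MapIso n x m y → MapIso m y n x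
  iso-sym x-distinct x-invClosed y-distinct y-invClosed α =
    mkMapIso (unapply α) (apply α) (unapply-apply α) (apply-unapply α) unapply-rot unapply-L
    where
    open Darts x x-distinct x-invClosed using () renaming (L to Lˣ; Lrel-L to Lrel-Lˣ)
    open Darts y y-distinct y-invClosed using () renaming (Lrel⇒≡L to Lrel⇒≡Lʸ)
    unapply-rot : ∀ e → unapply α (rot e) ≡ rot (unapply α e)
    unapply-rot e = begin
      unapply α (rot e)                       ≡⟨ cong (λ e′ → unapply α (rot e′)) (apply-unapply α e) ⟨
      unapply α (rot (apply α (unapply α e))) ≡⟨ cong (unapply α) (MapIso.φ-rot α (unapply α e)) ⟨
      unapply α (apply α (rot (unapply α e))) ≡⟨ unapply-apply α _ ⟩
      rot (unapply α e)                       ∎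
      where open ≡-Reasoning
    unapply-L : ∀ e e′ → Lrel m y e e′ → Lrel n x (unapply α e) (unapply α e′)
    unapply-L e e′ r = subst (Lrel n x (unapply α e)) (sym B[e′]≡Lˣ) (Lrel-Lˣ (unapply α e))
      where
      open ≡-Reasoning
      αLˣ : Lrel m y e (apply α (Lˣ (unapply α e)))
      αLˣ = subst (λ e₀ → Lrel m y e₀ (apply α (Lˣ (unapply α e)))) (apply-unapply α e)
                  (MapIso.φ-L α _ _ (Lrel-Lˣ (unapply α e)))
      B[e′]≡Lˣ : unapply α e′ ≡ Lˣ (unapply α e)
      B[e′]≡Lˣ = begin
        unapply α e′                              ≡⟨ cong (unapply α) (trans (Lrel⇒≡Lʸ r) (sym (Lrel⇒≡Lʸ αLˣ))) ⟩
        unapply α (apply α (Lˣ (unapply α e)))    ≡⟨ unapply-apply α _ ⟩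
        Lˣ (unapply α e)                          ∎

module _ {m : ℕ} .{{_ : NonZero m}} {y : Fin 3 → Dih m} where
  left-translation : Dih m → Aut⁺ m y
  left-translation h = mkMapIso (λ (g , k) → (h · g , k)) (λ (g , k) → (inv h · g , k))
    (λ (g , k) → cong (_, k) (trans (sym (·-assoc h (inv h) g)) (trans (cong (_· g) (inv-inverseʳ h)) (·-identityˡ g))))
    (λ (g , k) → cong (_, k) (trans (sym (·-assoc (inv h) h g)) (trans (cong (_· g) (inv-inverseˡ h)) (·-identityˡ g))))
    (λ _ → refl)
    (λ (g , k) (g′ , k′) (g′≡gy , r) → trans (cong (h ·_) g′≡gy) (sym (·-assoc h g (y k))) , r)
    where open Reduction m

  module _ (ρ : Aut⁺ m y) (ρ-one : ∀ k → apply ρ (one , k) ≡ (one , next k)) where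
    private
      turn : ∀ k k′ → Σ (Aut⁺ m y) λ α → apply α (one , k) ≡ (one , k′)
      turn k k′ with next-orbit k k′
      ... | inj₁ refl        = iso-refl , refl
      ... | inj₂ (inj₁ refl) = ρ , ρ-one k
      ... | inj₂ (inj₂ refl) = iso-trans ρ ρ , trans (cong (apply ρ) (ρ-one k)) (ρ-one (next k))

    regular-from-rotation : Regular m y
    regular-from-rotation (g , k) (g′ , k′) with turn k k′
    ... | α , αk≡k′ = iso-trans (left-translation (inv g)) (iso-trans α (left-translation g′)) , (begin
      apply (left-translation g′) (apply α (inv g · g , k))
        ≡⟨ cong (λ h → apply (left-translation g′) (apply α (h , k))) (inv-inverseˡ g) ⟩
      apply (left-translation g′) (apply α (one , k))        ≡⟨ cong (apply (left-translation g′)) αk≡k′ ⟩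
      (g′ · one , k′)                                        ≡⟨ cong (_, k′) (·-identityʳ g′) ⟩
      (g′ , k′)                                              ∎)
      where
      open ≡-Reasoning
      open Reduction m

module _ {n m : ℕ} .{{_ : NonZero n}} .{{_ : NonZero m}} {x : Fin 3 → Dih n} {y : Fin 3 → Dih m}
         (x-distinct : ∀ i j → x i ≡ x j → i ≡ j) (x-invClosed : ∀ i → ∃ λ j → x j ≡ inv (x i))
         (y-distinct : ∀ i j → y i ≡ y j → i ≡ j) (y-invClosed : ∀ i → ∃ λ j → y j ≡ inv (y i)) where

  reflexibleRegular-transport : MapIso n x m y → ReflexibleRegular m y → ReflexibleRegular n x
  reflexibleRegular-transport α (regular , ψ) = regularˣ , mirrorˣ
    where
    α⁻ : MapIso m y n x
    α⁻ = iso-sym x-distinct x-invClosed y-distinct y-invClosed α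

    regularˣ : Regular n x
    regularˣ d d′ with regular (apply α d) (apply α d′)
    ... | β , βd≡d′ = iso-trans α (iso-trans β α⁻) , trans (cong (unapply α) βd≡d′) (unapply-apply α d′)

    conj conj⁻ : Dart n → Dart n
    conj d  = unapply α (applyRev ψ (apply α d))
    conj⁻ d = unapply α (unapplyRev ψ (apply α d))

    conj-rot : ∀ d → conj (rot d) ≡ rot (rot (conj d))
    conj-rot d = begin
      unapply α (applyRev ψ (apply α (rot d)))         ≡⟨ cong (λ e → unapply α (applyRev ψ e)) (MapIso.φ-rot α d) ⟩
      unapply α (applyRev ψ (rot (apply α d)))         ≡⟨ cong (unapply α) (applyRev-rot ψ (apply α d)) ⟩
      unapply α (rot (rot (applyRev ψ (apply α d))))   ≡⟨ MapIso.φ-rot α⁻ _ ⟩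
      rot (unapply α (rot (applyRev ψ (apply α d))))   ≡⟨ cong rot (MapIso.φ-rot α⁻ _) ⟩
      rot (rot (conj d))                               ∎
      where open ≡-Reasoning

    mirrorˣ : AutRev n x
    mirrorˣ = mkAutRev conj conj⁻
      (λ e → trans (cong (unapply α) (trans (cong (applyRev ψ) (apply-unapply α _)) (applyRev-unapplyRev ψ _))) (unapply-apply α e))
      (λ d → trans (cong (unapply α) (trans (cong (unapplyRev ψ) (apply-unapply α _)) (unapplyRev-applyRev ψ _))) (unapply-apply α d))
      conj-rot
      (λ d d′ r → MapIso.φ-L α⁻ _ _ (AutRev.ψ-L ψ _ _ (MapIso.φ-L α d d′ r)))

module Generation (n : ℕ) .{{_ : NonZero n}} (x : Fin 3 → Dih n) (C : IsCayley3 n x) where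
  open Congruence n
  open Reduction n
  open IsCayley3 C

  generated-induction : (P : Dih n → Set) → P one → (∀ k g → P g → P (x k · g)) → ∀ g → P g
  generated-induction P P-one P-step g with generates g
  ... | ws , ∏ws≡g = subst P ∏ws≡g (go ws)
    where
    go : ∀ ws → P (product (List.map x ws))
    go []       = P-one
    go (k ∷ ws) = P-step k _ (go ws)

  some-reflection : ¬ (∀ k → proj₂ (x k) ≡ false)
  some-reflection all-rotations = true≢false (generated-induction (λ g → proj₂ g ≡ false) refl step gen-b)
    where
    step : ∀ k g → proj₂ g ≡ false → proj₂ (x k · g) ≡ false
    step k g g-rotation with x k | all-rotations k
    ... | (i , false) | refl = g-rotation

  -- The elements satisfying Annihilates c r form a subgroup, so containing X it contains a, whence n ∣ c.
  Annihilates : ℤ → ℤ → D∞ → Set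
  Annihilates c r (A , false) = + n ∣ c * A
  Annihilates c r (A , true)  = + n ∣ c * (A - r)

  annihilates-⋆ : ∀ c r P Q → Annihilates c r P → Annihilates c r Q → Annihilates c r (P ⋆ Q)
  annihilates-⋆ c r (A , false) (B , false) p q = ∣-by (∣m∣n⇒∣m+n p q) (solve (c ∷ A ∷ B ∷ []))
  annihilates-⋆ c r (A , false) (B , true)  p q = ∣-by (∣m∣n⇒∣m+n p q) (solve (c ∷ A ∷ B ∷ r ∷ []))
  annihilates-⋆ c r (A , true)  (B , false) p q = ∣-by (∣m∣n⇒∣m+n p (∣m⇒∣-m q)) (solve (c ∷ A ∷ B ∷ r ∷ []))
  annihilates-⋆ c r (A , true)  (B , true)  p q = ∣-by (∣m∣n⇒∣m+n p (∣m⇒∣-m q)) (solve (c ∷ A ∷ B ∷ r ∷ []))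

  annihilates-resp : ∀ c r {P Q} → P ≈ Q → Annihilates c r P → Annihilates c r Q
  annihilates-resp c r {A , false} {B , .false} (refl , mk≋ A-B) p =
    ∣-by (∣m∣n⇒∣m+n p (∣m⇒∣-m (∣n⇒∣m*n c A-B))) (solve (c ∷ A ∷ B ∷ []))
  annihilates-resp c r {A , true}  {B , .true}  (refl , mk≋ A-B) p =
    ∣-by (∣m∣n⇒∣m+n p (∣m⇒∣-m (∣n⇒∣m*n c A-B))) (solve (c ∷ A ∷ B ∷ r ∷ []))

  annihilates-generators⇒∣ : ∀ c r → (∀ k → Annihilates c r (lift (x k))) → + n ∣ c
  annihilates-generators⇒∣ c r ann-x =
    ∣-by (annihilates-resp c r {Q = 1ℤ , false} (refl , ⟦mod⟧ 1) (generated-induction P P-one P-step gen-a))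
         (ℤ.*-identityʳ c)
    where
    P : Dih n → Set
    P g = Annihilates c r (lift g)
    P-one : P one
    P-one = annihilates-resp c r (≈-sym lift-one) (∣-by n∣0 (sym (ℤ.*-zeroʳ c)))
    P-step : ∀ k g → P g → P (x k · g)
    P-step k g Pg = annihilates-resp c r (≈-sym (lift-· (x k) g)) (annihilates-⋆ c r _ _ (ann-x k) Pg)

module Classification (n : ℕ) .{{_ : NonZero n}} (x : Fin 3 → Dih n) (C : IsCayley3 n x) where
  open Congruence n
  open Reduction n
  open IsCayley3 C
  open Generation n x C
  open Darts x distinct invClosed

  A : Fin 3 → ℤ
  A k = ⟦ proj₁ (x k) ⟧

  x-lift : ∀ {k e} → proj₂ (x k) ≡ e → lift (x k) ≈ (A k , e)
  x-lift e = e , ≋-refl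

  ι-flag : ∀ k → proj₂ (x (ι k)) ≡ proj₂ (x k)
  ι-flag k = trans (cong proj₂ (x-ι k)) (inv-flag (x k))

  ι-reflection : ∀ {k} → proj₂ (x k) ≡ true → ι k ≡ k
  ι-reflection {k} e = distinct _ _ (trans (x-ι k) (inv-reflection (x k) e))

  ι-involutive : ∀ k → ι (ι k) ≡ k
  ι-involutive k = distinct _ _ (trans (x-ι (ι k)) (trans (cong inv (x-ι k)) (inv-involutive (x k))))

  F-step : ∀ g {j j′} → ι j ≡ j′ → F (g , j) ≡ (g · x j , next j′)
  F-step g {j} = cong (λ i → (g · x j , next i))

  G-step : ∀ g {j j′} → ι j ≡ j′ → G (g , j) ≡ (g · x j , next (next j′))
  G-step g {j} = cong (λ i → (g · x j , next (next i)))

  GF-involutive : (∀ j → ι j ≡ j) → ∀ g j → G (F (g , j)) ≡ ((g · x j) · x (next j) , j)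
  GF-involutive ι≡id g j =
    trans (cong G (F-step g (ι≡id j))) (trans (G-step (g · x j) (ι≡id (next j))) (cong ((g · x j) · x (next j) ,_) (next³ j)))

  FG-involutive : (∀ j → ι j ≡ j) → ∀ g j → F (G (g , j)) ≡ ((g · x j) · x (next (next j)) , j)
  FG-involutive ι≡id g j =
    trans (cong F (G-step g (ι≡id j)))
          (trans (F-step (g · x j) (ι≡id (next (next j)))) (cong ((g · x j) · x (next (next j)) ,_) (next³ j)))

  ι-unique-flag : ∀ k → proj₂ (x (next k)) ≢ proj₂ (x k) → proj₂ (x (next (next k))) ≢ proj₂ (x k) → ι k ≡ k
  ι-unique-flag k e₁ e₂ with next-orbit k (ι k)
  ... | inj₁ ιk≡k         = ιk≡k
  ... | inj₂ (inj₁ ιk≡k₁) = ⊥-elim (e₁ (trans (cong (λ j → proj₂ (x j)) (sym ιk≡k₁)) (ι-flag k)))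
  ... | inj₂ (inj₂ ιk≡k₂) = ⊥-elim (e₂ (trans (cong (λ j → proj₂ (x j)) (sym ιk≡k₂)) (ι-flag k)))

  annihilates-reflection : ∀ c {k} → proj₂ (x k) ≡ true → Annihilates c (A k) (lift (x k))
  annihilates-reflection c {k} e = annihilates-resp c (A k) (≈-sym (x-lift e)) (∣-by n∣0 (identity c (A k)))
    where
    identity : ∀ c a → 0ℤ ≡ c * (a - a)
    identity = solve-∀

  two-reflections⇒∣2 : Regular n x → ∀ k → proj₂ (x k) ≡ false → proj₂ (x (next k)) ≡ true →
                    proj₂ (x (next (next k))) ≡ true → n ℕ.∣ 2
  two-reflections⇒∣2 regular k e₀ e₁ e₂ = ∣⇒∣ᵤ (annihilates-generators⇒∣ (+ 2) (A k₁) annihilates)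
    where
    k₁ k₂ : Fin 3
    k₁ = next k
    k₂ = next k₁
    ι≡id : ∀ j → ι j ≡ j
    ι≡id j with next-orbit k j
    ... | inj₁ refl        = ι-unique-flag k (λ e → true≢false (trans (sym e₁) (trans e e₀)))
                                             (λ e → true≢false (trans (sym e₂) (trans e e₀)))
    ... | inj₂ (inj₁ refl) = ι-reflection e₁
    ... | inj₂ (inj₂ refl) = ι-reflection e₂
    W : Dart n → Dart n
    W d = G (F (G (F d)))
    W-natural : Natural W
    W-natural = ∘-natural (∘-natural G-natural F-natural) (∘-natural G-natural F-natural)
    W-one : ∀ j → W (one , j) ≡ ((((one · x j) · x (next j)) · x j) · x (next j) , j)
    W-one j = trans (cong (λ d → G (F d)) (GF-involutive ι≡id one j)) (GF-involutive ι≡id _ j)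
    W-fixes-k : W (one , k) ≡ (one , k)
    W-fixes-k = trans (W-one k) (cong (_, k) (rotation-reflection-square (x-lift e₀) (x-lift e₁)))
    [x₁x₂]²≡1 : (((one · x k₁) · x k₂) · x k₁) · x k₂ ≡ one
    [x₁x₂]²≡1 = cong proj₁ (trans (sym (W-one k₁)) (fixed-everywhere regular W-natural W-fixes-k (one , k₁)))
    identity : ∀ a b → - (+ 2 * (a - b)) ≡ + 2 * (b - a)
    identity = solve-∀
    annihilates : ∀ j → Annihilates (+ 2) (A k₁) (lift (x j))
    annihilates j with next-orbit k j
    ... | inj₁ refl        = annihilates-resp (+ 2) (A k₁) (≈-sym (x-lift e₀))
                               (rotation-involution (x-lift e₀) (trans (cong x (sym (ι≡id _))) (x-ι _)))
    ... | inj₂ (inj₁ refl) = annihilates-reflection (+ 2) e₁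
    ... | inj₂ (inj₂ refl) = annihilates-resp (+ 2) (A k₁) (≈-sym (x-lift e₂))
                               (∣-by (∣m⇒∣-m (reflections-square (x-lift e₁) (x-lift e₂) [x₁x₂]²≡1))
                                     (identity (A k₁) (A k₂)))

  involutive-rotations⇒∣2 : ∀ k → proj₂ (x k) ≡ true → proj₂ (x (next k)) ≡ false → proj₂ (x (next (next k))) ≡ false →
                         ι (next k) ≡ next k → n ℕ.∣ 2
  involutive-rotations⇒∣2 k e₀ e₁ e₂ ιk₁≡k₁ = ∣⇒∣ᵤ (annihilates-generators⇒∣ (+ 2) (A k) annihilates)
    where
    k₁ k₂ : Fin 3
    k₁ = next k
    k₂ = next k₁
    ιk₂≡k₂ : ι k₂ ≡ k₂
    ιk₂≡k₂ with next-orbit k (ι k₂)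
    ... | inj₁ ιk₂≡k         =
      ⊥-elim (true≢false (trans (sym e₀) (trans (cong (λ j → proj₂ (x j)) (sym ιk₂≡k)) (trans (ι-flag k₂) e₂))))
    ... | inj₂ (inj₁ ιk₂≡k₁) =
      ⊥-elim (next≢next² k (trans (sym ιk₁≡k₁) (trans (cong ι (sym ιk₂≡k₁)) (ι-involutive k₂))))
    ... | inj₂ (inj₂ ιk₂≡k₂) = ιk₂≡k₂
    annihilates : ∀ j → Annihilates (+ 2) (A k) (lift (x j))
    annihilates j with next-orbit k j
    ... | inj₁ refl        = annihilates-reflection (+ 2) e₀
    ... | inj₂ (inj₁ refl) = annihilates-resp (+ 2) (A k) (≈-sym (x-lift e₁))
                               (rotation-involution (x-lift e₁) (trans (cong x (sym ιk₁≡k₁)) (x-ι _)))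
    ... | inj₂ (inj₂ refl) = annihilates-resp (+ 2) (A k) (≈-sym (x-lift e₂))
                               (rotation-involution (x-lift e₂) (trans (cong x (sym ιk₂≡k₂)) (x-ι _)))

  inverse-rotations⇒∣4 : Regular n x → ∀ k → proj₂ (x k) ≡ true → proj₂ (x (next k)) ≡ false →
                      proj₂ (x (next (next k))) ≡ false → ι (next k) ≡ next (next k) → n ℕ.∣ 4
  inverse-rotations⇒∣4 regular k e₀ e₁ e₂ ιk₁≡k₂ = ∣⇒∣ᵤ (annihilates-generators⇒∣ (+ 4) (A k) annihilates)
    where
    k₁ k₂ : Fin 3
    k₁ = next k
    k₂ = next k₁
    ιk₂≡k₁ : ι k₂ ≡ k₁
    ιk₂≡k₁ = trans (cong ι (sym ιk₁≡k₂)) (ι-involutive k₁)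
    F²-at-k : ∀ g → F (F (g , k)) ≡ ((g · x k) · x k₁ , k)
    F²-at-k g = trans (cong F (F-step g (ι-reflection e₀)))
                      (trans (F-step (g · x k) ιk₁≡k₂) (cong ((g · x k) · x k₁ ,_) (next³ k)))
    F-at-k₂ : ∀ g → F (g , k₂) ≡ (g · x k₂ , k₂)
    F-at-k₂ g = F-step g ιk₂≡k₁
    W : Dart n → Dart n
    W d = F (F (F (F d)))
    W-natural : Natural W
    W-natural = ∘-natural F-natural (∘-natural F-natural (∘-natural F-natural F-natural))
    W-fixes-k : W (one , k) ≡ (one , k)
    W-fixes-k = begin
      F (F (F (F (one , k))))                           ≡⟨ cong (λ d → F (F d)) (F²-at-k one) ⟩
      F (F ((one · x k) · x k₁ , k))                    ≡⟨ F²-at-k _ ⟩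
      ((((one · x k) · x k₁) · x k) · x k₁ , k)         ≡⟨ cong (_, k) (reflection-rotation-square (x-lift e₀) (x-lift e₁)) ⟩
      (one , k)                                         ∎
      where open ≡-Reasoning
    W-at-k₂ : W (one , k₂) ≡ ((((one · x k₂) · x k₂) · x k₂) · x k₂ , k₂)
    W-at-k₂ = begin
      F (F (F (F (one , k₂))))                          ≡⟨ cong (λ d → F (F (F d))) (F-at-k₂ one) ⟩
      F (F (F (one · x k₂ , k₂)))                       ≡⟨ cong (λ d → F (F d)) (F-at-k₂ (one · x k₂)) ⟩
      F (F ((one · x k₂) · x k₂ , k₂))                  ≡⟨ cong F (F-at-k₂ ((one · x k₂) · x k₂)) ⟩
      F (((one · x k₂) · x k₂) · x k₂ , k₂)             ≡⟨ F-at-k₂ (((one · x k₂) · x k₂) · x k₂) ⟩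
      ((((one · x k₂) · x k₂) · x k₂) · x k₂ , k₂)      ∎
      where open ≡-Reasoning
    n∣4A₂ : + n ∣ + 4 * A k₂
    n∣4A₂ = rotation-fourth-power (x-lift e₂)
              (cong proj₁ (trans (sym W-at-k₂) (fixed-everywhere regular W-natural W-fixes-k (one , k₂))))
    x₁≈-A₂ : lift (x k₁) ≈ (- A k₂ , false)
    x₁≈-A₂ = ≈-trans (≈-reflexive (cong lift (trans (cong x (sym ιk₂≡k₁)) (x-ι k₂))))
               (≈-trans (lift-inv (x k₂)) (inv∞-cong (x-lift e₂)))
    annihilates : ∀ j → Annihilates (+ 4) (A k) (lift (x j))
    annihilates j with next-orbit k j
    ... | inj₁ refl        = annihilates-reflection (+ 4) e₀
    ... | inj₂ (inj₁ refl) = annihilates-resp (+ 4) (A k) (≈-sym x₁≈-A₂) (∣-by (∣m⇒∣-m n∣4A₂) (identity (A k₂)))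
      where
      identity : ∀ a → - (+ 4 * a) ≡ + 4 * - a
      identity = solve-∀
    ... | inj₂ (inj₂ refl) = annihilates-resp (+ 4) (A k) (≈-sym (x-lift e₂)) n∣4A₂

  three-reflections⇒∣3 : ReflexibleRegular n x → (∀ k → proj₂ (x k) ≡ true) → n ℕ.∣ 3
  three-reflections⇒∣3 (regular , ψ) reflection = ∣⇒∣ᵤ (quadratic-relations⇒∣3 u v generate D F₁ F₂)
    where
    k₀ k₁ k₂ : Fin 3
    k₀ = f0
    k₁ = fs f0
    k₂ = fs (fs f0)
    u v : ℤ
    u = A k₀ - A k₁
    v = A k₀ - A k₂
    -- Chosen so that W below fixes (1 , k₀).
    p q : ℕ
    p = proj₁ (≋-representative v)
    q = proj₁ (≋-representative (- u))

    generate : ∀ c → + n ∣ c * u → + n ∣ c * v → + n ∣ c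
    generate c n∣cu n∣cv = annihilates-generators⇒∣ c (A k₀) annihilates
      where
      identity : ∀ c a b → - (c * (a - b)) ≡ c * (b - a)
      identity = solve-∀
      annihilates : ∀ j → Annihilates c (A k₀) (lift (x j))
      annihilates f0           = annihilates-reflection c (reflection k₀)
      annihilates (fs f0)      = annihilates-resp c (A k₀) (≈-sym (x-lift (reflection k₁)))
                                   (∣-by (∣m⇒∣-m n∣cu) (identity c (A k₀) (A k₁)))
      annihilates (fs (fs f0)) = annihilates-resp c (A k₀) (≈-sym (x-lift (reflection k₂)))
                                   (∣-by (∣m⇒∣-m n∣cv) (identity c (A k₀) (A k₂)))

    ι≡id : ∀ j → ι j ≡ j
    ι≡id j = ι-reflection (reflection j)
    GF FG : Dart n → Dart n
    GF d = G (F d)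
    FG d = F (G d)
    W W̄ : Dart n → Dart n
    W d = iterate FG (iterate GF d p) q
    W̄ d = iterate GF (iterate FG d p) q

    W-natural : Natural W
    W-natural = ∘-natural (iterate-natural (∘-natural F-natural G-natural) q) (iterate-natural (∘-natural G-natural F-natural) p)
    W̄-natural : Natural W̄
    W̄-natural = ∘-natural (iterate-natural (∘-natural G-natural F-natural) q) (iterate-natural (∘-natural F-natural G-natural) p)
    W-mirror : ∀ d → applyRev ψ (W d) ≡ W̄ (applyRev ψ d)
    W-mirror d = trans (iterate-conj (applyRev ψ) FG-mirror (iterate GF d p) q)
                       (cong (λ e → iterate GF e q) (iterate-conj (applyRev ψ) GF-mirror d p))
      where
      GF-mirror : ∀ d → applyRev ψ (GF d) ≡ FG (applyRev ψ d)
      GF-mirror d = trans (G-mirror ψ (F d)) (cong F (F-mirror ψ d))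
      FG-mirror : ∀ d → applyRev ψ (FG d) ≡ GF (applyRev ψ d)
      FG-mirror d = trans (F-mirror ψ (G d)) (cong G (G-mirror ψ d))

    walk : ∀ j j₁ j₂ {w₁ w₂ : Dart n → Dart n} →
           (∀ g → w₁ (g , j) ≡ ((g · x j) · x j₁ , j)) → (∀ g → w₂ (g , j) ≡ ((g · x j) · x j₂ , j)) →
           ∃ λ h → iterate w₂ (iterate w₁ (one , j) p) q ≡ (h , j) ×
                   lift h ≈ (0ℤ + + p * (A j - A j₁) + + q * (A j - A j₂) , false)
    walk j j₁ j₂ {w₁} {w₂} w₁-at w₂-at = _ , at , lift-iterate-reflections xj xj₂ (lift-iterate-reflections xj xj₁ lift-one p) q
      where
      xj = x-lift (reflection j)
      xj₁ = x-lift (reflection j₁)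
      xj₂ = x-lift (reflection j₂)
      at = trans (cong (λ d → iterate w₂ d q) (sym (iterate-conj (_, j) (λ g → sym (w₁-at g)) one p)))
                 (sym (iterate-conj (_, j) (λ g → sym (w₂-at g)) _ q))

    E-subst : ∀ {j j₁ j₂} → 0ℤ + + p * (A j - A j₁) + + q * (A j - A j₂) ≋ 0ℤ + v * (A j - A j₁) + - u * (A j - A j₂)
    E-subst {j} {j₁} {j₂} = +-cong (+-cong (≋-refl {0ℤ}) (*-congʳ (A j - A j₁) (proj₂ (≋-representative v))))
                                   (*-congʳ (A j - A j₂) (proj₂ (≋-representative (- u))))

    fixed⇒∣ : ∀ j j₁ j₂ {w₁ w₂ : Dart n → Dart n} → (∀ g → w₁ (g , j) ≡ ((g · x j) · x j₁ , j)) →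
              (∀ g → w₂ (g , j) ≡ ((g · x j) · x j₂ , j)) → iterate w₂ (iterate w₁ (one , j) p) q ≡ (one , j) →
              + n ∣ 0ℤ + v * (A j - A j₁) + - u * (A j - A j₂)
    fixed⇒∣ j j₁ j₂ w₁-at w₂-at fixed with walk j j₁ j₂ w₁-at w₂-at
    ... | h , at , h≈ = ≋0⇒∣ (≋-trans (≋-sym E-subst) (≡one⇒≋0 (cong proj₁ (trans (sym at) fixed)) h≈))

    W-fixes-k₀ : W (one , k₀) ≡ (one , k₀)
    W-fixes-k₀ with walk k₀ k₁ k₂ (λ g → GF-involutive ι≡id g k₀) (λ g → FG-involutive ι≡id g k₀)
    ... | h , at , h≈ = trans at (cong (_, k₀) (≋0⇒≡one h≈ (≋-trans E-subst (≋-reflexive (identity u v)))))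
      where
      identity : ∀ u v → 0ℤ + v * u + - u * v ≡ 0ℤ
      identity = solve-∀

    D : + n ∣ v * (v - u) + u * u
    D = ∣-by (fixed⇒∣ k₁ k₂ k₀ (λ g → GF-involutive ι≡id g k₁) (λ g → FG-involutive ι≡id g k₁)
                (fixed-everywhere regular W-natural W-fixes-k₀ (one , k₁)))
             (identity (A k₀) (A k₁) (A k₂))
      where
      identity : ∀ a₀ a₁ a₂ → 0ℤ + (a₀ - a₂) * (a₁ - a₂) + - (a₀ - a₁) * (a₁ - a₀) ≡
                              (a₀ - a₂) * ((a₀ - a₂) - (a₀ - a₁)) + (a₀ - a₁) * (a₀ - a₁)
      identity = solve-∀

    F₁ : + n ∣ u * u - + 2 * (u * v)
    F₁ = ∣-by (fixed⇒∣ k₁ k₀ k₂ (λ g → FG-involutive ι≡id g k₁) (λ g → GF-involutive ι≡id g k₁)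
                 (fixed-everywhere-mirrored regular ψ W̄-natural W-mirror W-fixes-k₀ (one , k₁)))
              (identity (A k₀) (A k₁) (A k₂))
      where
      identity : ∀ a₀ a₁ a₂ → 0ℤ + (a₀ - a₂) * (a₁ - a₀) + - (a₀ - a₁) * (a₁ - a₂) ≡
                              (a₀ - a₁) * (a₀ - a₁) - + 2 * ((a₀ - a₁) * (a₀ - a₂))
      identity = solve-∀

    F₂ : + n ∣ + 2 * (u * v) - v * v
    F₂ = ∣-by (fixed⇒∣ k₂ k₁ k₀ (λ g → FG-involutive ι≡id g k₂) (λ g → GF-involutive ι≡id g k₂)
                 (fixed-everywhere-mirrored regular ψ W̄-natural W-mirror W-fixes-k₀ (one , k₂)))
              (identity (A k₀) (A k₁) (A k₂))
      where
      identity : ∀ a₀ a₁ a₂ → 0ℤ + (a₀ - a₂) * (a₂ - a₁) + - (a₀ - a₁) * (a₂ - a₀) ≡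
                              + 2 * ((a₀ - a₁) * (a₀ - a₂)) - (a₀ - a₂) * (a₀ - a₂)
      identity = solve-∀

  one-reflection⇒∣2⊎∣4 : Regular n x → ∀ k → proj₂ (x k) ≡ true → proj₂ (x (next k)) ≡ false →
                         proj₂ (x (next (next k))) ≡ false → n ℕ.∣ 2 ⊎ (n ℕ.∣ 4 × x (next (next k)) ≡ inv (x (next k)))
  one-reflection⇒∣2⊎∣4 regular k e₀ e₁ e₂ with next-orbit k (ι (next k))
  ... | inj₁ ιk₁≡k         =
    ⊥-elim (true≢false (trans (sym e₀) (trans (cong (λ j → proj₂ (x j)) (sym ιk₁≡k)) (trans (ι-flag (next k)) e₁))))
  ... | inj₂ (inj₁ ιk₁≡k₁) = inj₁ (involutive-rotations⇒∣2 k e₀ e₁ e₂ ιk₁≡k₁)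
  ... | inj₂ (inj₂ ιk₁≡k₂) =
    inj₂ (inverse-rotations⇒∣4 regular k e₀ e₁ e₂ ιk₁≡k₂ , trans (cong x (sym ιk₁≡k₂)) (x-ι (next k)))

data ReflectionPattern (b : Fin 3 → Bool) : Set where
  none : (∀ k → b k ≡ false) → ReflectionPattern b
  exactlyOne : ∀ k → b k ≡ true → b (next k) ≡ false → b (next (next k)) ≡ false → ReflectionPattern b
  exactlyTwo : ∀ k → b k ≡ false → b (next k) ≡ true → b (next (next k)) ≡ true → ReflectionPattern b
  allThree : (∀ k → b k ≡ true) → ReflectionPattern b

reflectionPattern : ∀ b → ReflectionPattern b
reflectionPattern b with b f0 in e₀ | b (fs f0) in e₁ | b (fs (fs f0)) in e₂
... | false | false | false = none λ { f0 → e₀ ; (fs f0) → e₁ ; (fs (fs f0)) → e₂ }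
... | true  | false | false = exactlyOne f0 e₀ e₁ e₂
... | false | true  | false = exactlyOne (fs f0) e₁ e₂ e₀
... | false | false | true  = exactlyOne (fs (fs f0)) e₂ e₀ e₁
... | false | true  | true  = exactlyTwo f0 e₀ e₁ e₂
... | true  | false | true  = exactlyTwo (fs f0) e₁ e₂ e₀
... | true  | true  | false = exactlyTwo (fs (fs f0)) e₂ e₀ e₁
... | true  | true  | true  = allThree λ { f0 → e₀ ; (fs f0) → e₁ ; (fs (fs f0)) → e₂ }

-- Small dihedral groups and the exceptional maps

_≟ᴰ_ : ∀ {m} → DecidableEquality (Dih m)
_≟ᴰ_ = ≡-dec Fin._≟_ Bool._≟_

_≟ᵈ_ : ∀ {m} → DecidableEquality (Dart m)
_≟ᵈ_ = ≡-dec _≟ᴰ_ Fin._≟_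

∀-Bool? : {P : Bool → Set} → (∀ b → Dec (P b)) → Dec (∀ b → P b)
∀-Bool? P? = map′ (λ (t , f) → λ { true → t ; false → f }) (λ h → h true , h false) (P? true ×-dec P? false)

∀-Dih? : ∀ {m} {P : Dih m → Set} → (∀ g → Dec (P g)) → Dec (∀ g → P g)
∀-Dih? P? = map′ (λ h (i , e) → h i e) (λ h i e → h (i , e)) (Fin.all? λ i → ∀-Bool? λ e → P? (i , e))

∀-Dart? : ∀ {m} {P : Dart m → Set} → (∀ d → Dec (P d)) → Dec (∀ d → P d)
∀-Dart? P? = map′ (λ h (g , k) → h g k) (λ h g k → h (g , k)) (∀-Dih? λ g → Fin.all? λ k → P? (g , k))

affine∞ : ℤ → ℤ → D∞ → D∞
affine∞ s t (A , false) = (s * A , false)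
affine∞ s t (A , true)  = (s * A + t , true)

affine∞-⋆ : ∀ s t P Q → affine∞ s t (P ⋆ Q) ≡ affine∞ s t P ⋆ affine∞ s t Q
affine∞-⋆ s t (A , false) (B , false) = cong (_, false) (ℤ.*-distribˡ-+ s A B)
affine∞-⋆ s t (A , false) (B , true)  = cong (_, true) (identity s t A B)
  where
  identity : ∀ s t A B → s * (A + B) + t ≡ s * A + (s * B + t)
  identity = solve-∀
affine∞-⋆ s t (A , true)  (B , false) = cong (_, true) (identity s t A B)
  where
  identity : ∀ s t A B → s * (A - B) + t ≡ s * A + t - s * B
  identity = solve-∀
affine∞-⋆ s t (A , true)  (B , true)  = cong (_, false) (identity s t A B)
  where
  identity : ∀ s t A B → s * (A - B) ≡ s * A + t - (s * B + t)
  identity = solve-∀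

affine∞-inv : ∀ s t P → affine∞ s t (inv∞ P) ≡ inv∞ (affine∞ s t P)
affine∞-inv s t (A , false) = cong (_, false) (sym (ℤ.neg-distribʳ-* s A))
affine∞-inv s t (A , true)  = refl

module Affine (n : ℕ) .{{_ : NonZero n}} where
  open Congruence n
  open Reduction n

  affine : ℕ → ℕ → Dih n → Dih n
  affine s t (i , false) = ((s ℕ.* toℕ i) mod n , false)
  affine s t (i , true)  = ((s ℕ.* toℕ i ℕ.+ t) mod n , true)

  affine∞-cong : ∀ s t {P Q} → P ≈ Q → affine∞ s t P ≈ affine∞ s t Q
  affine∞-cong s t {_ , false} {_ , .false} (refl , a) = refl , *-congˡ s a
  affine∞-cong s t {_ , true}  {_ , .true}  (refl , a) = refl , +-cong (*-congˡ s a) (≋-refl {t})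

  lift-affine : ∀ s t g → lift (affine s t g) ≈ affine∞ (+ s) (+ t) (lift g)
  lift-affine s t (i , false) = refl , ≋-trans (⟦mod⟧ _) (≋-reflexive (ℤ.pos-* s (toℕ i)))
  lift-affine s t (i , true)  = refl , ≋-trans (⟦mod⟧ _)
    (≋-reflexive (trans (ℤ.pos-+ (s ℕ.* toℕ i) t) (cong (_+ + t) (ℤ.pos-* s (toℕ i)))))

  affine-· : ∀ s t g h → affine s t (g · h) ≡ affine s t g · affine s t h
  affine-· s t g h = lift-injective (begin
    lift (affine s t (g · h))                            ≈⟨ lift-affine s t (g · h) ⟩
    affine∞ (+ s) (+ t) (lift (g · h))                   ≈⟨ affine∞-cong (+ s) (+ t) (lift-· g h) ⟩
    affine∞ (+ s) (+ t) (lift g ⋆ lift h)                ≡⟨ affine∞-⋆ (+ s) (+ t) (lift g) (lift h) ⟩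
    affine∞ (+ s) (+ t) (lift g) ⋆ affine∞ (+ s) (+ t) (lift h)
                                                         ≈⟨ ⋆-cong (lift-affine s t g) (lift-affine s t h) ⟨
    lift (affine s t g) ⋆ lift (affine s t h)            ≈⟨ lift-· (affine s t g) (affine s t h) ⟨
    lift (affine s t g · affine s t h)                   ∎)
    where open SetoidReasoning ≈-setoid

  affine-inv : ∀ s t g → affine s t (inv g) ≡ inv (affine s t g)
  affine-inv s t g = lift-injective (begin
    lift (affine s t (inv g))                ≈⟨ lift-affine s t (inv g) ⟩
    affine∞ (+ s) (+ t) (lift (inv g))       ≈⟨ affine∞-cong (+ s) (+ t) (lift-inv g) ⟩
    affine∞ (+ s) (+ t) (inv∞ (lift g))      ≡⟨ affine∞-inv (+ s) (+ t) (lift g) ⟩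
    inv∞ (affine∞ (+ s) (+ t) (lift g))      ≈⟨ inv∞-cong (lift-affine s t g) ⟨
    inv∞ (lift (affine s t g))               ≈⟨ lift-inv (affine s t g) ⟨
    lift (inv (affine s t g))                ∎)
    where open SetoidReasoning ≈-setoid

  AffineMatch : Dih n → Dih n → Dih n → (Fin 3 → Dih n) → Set
  AffineMatch u v w y = ∃ λ (s : Fin n) → ∃ λ (t : Fin n) → ∃ λ (t′ : Fin n) →
    (∀ g → affine (toℕ s) (toℕ t) (affine (toℕ s) (toℕ t′) g) ≡ g) ×
    (∀ g → affine (toℕ s) (toℕ t′) (affine (toℕ s) (toℕ t) g) ≡ g) ×
    affine (toℕ s) (toℕ t) u ≡ y f0 × affine (toℕ s) (toℕ t) v ≡ y (fs f0) × affine (toℕ s) (toℕ t) w ≡ y (fs (fs f0))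

  affineMatch? : ∀ u v w y → Dec (AffineMatch u v w y)
  affineMatch? u v w y = Fin.any? λ s → Fin.any? λ t → Fin.any? λ t′ →
    ∀-Dih? (λ g → affine (toℕ s) (toℕ t) (affine (toℕ s) (toℕ t′) g) ≟ᴰ g) ×-dec
    ∀-Dih? (λ g → affine (toℕ s) (toℕ t′) (affine (toℕ s) (toℕ t) g) ≟ᴰ g) ×-dec
    affine (toℕ s) (toℕ t) u ≟ᴰ y f0 ×-dec affine (toℕ s) (toℕ t) v ≟ᴰ y (fs f0) ×-dec
    affine (toℕ s) (toℕ t) w ≟ᴰ y (fs (fs f0))

  affine-match-iso : ∀ {x y : Fin 3 → Dih n} k → AffineMatch (x k) (x (next k)) (x (next (next k))) y → MapIso n x n y
  affine-match-iso {x} {y} k (s , t , t′ , inverseˡ , inverseʳ , u↦ , v↦ , w↦) =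
    mkMapIso (λ (g , i) → (f g , -₃ k +₃ i)) (λ (g , j) → (f⁻ g , k +₃ j))
      (λ (g , j) → cong₂ _,_ (inverseˡ g) (-₃-cancelˡ k j))
      (λ (g , i) → cong₂ _,_ (inverseʳ g) (-₃-cancelʳ k i))
      (λ (g , i) → cong (f g ,_) (+₃-next (-₃ k) i))
      (λ (g , i) (g′ , i′) (g′≡gx , x′≡x⁻¹) →
         trans (cong f g′≡gx) (trans (affine-· _ _ g (x i)) (cong (f g ·_) (f-x i))) ,
         trans (sym (f-x i′)) (trans (cong f x′≡x⁻¹) (trans (affine-inv _ _ (x i)) (cong inv (f-x i)))))
    where
    f f⁻ : Dih n → Dih n
    f  = affine (toℕ s) (toℕ t)
    f⁻ = affine (toℕ s) (toℕ t′)
    f-x-shifted : ∀ j → f (x (k +₃ j)) ≡ y j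
    f-x-shifted f0           = u↦
    f-x-shifted (fs f0)      = v↦
    f-x-shifted (fs (fs f0)) = w↦
    f-x : ∀ i → f (x i) ≡ y (-₃ k +₃ i)
    f-x i = trans (cong (λ j → f (x j)) (sym (-₃-cancelʳ k i))) (f-x-shifted (-₃ k +₃ i))

open Affine using (AffineMatch; affineMatch?; affine-match-iso)

rotation-D₁ : ∀ (v : Dih 1) → proj₂ v ≡ false → v ≡ one
rotation-D₁ = from-yes (∀-Dih? {1} λ v → (proj₂ v Bool.≟ false) →-dec (v ≟ᴰ one))

reflections-D₁ : ∀ (u v : Dih 1) → proj₂ u ≡ true → proj₂ v ≡ true → u ≡ v
reflections-D₁ = from-yes (∀-Dih? {1} λ u → ∀-Dih? {1} λ v →
                   (proj₂ u Bool.≟ true) →-dec (proj₂ v Bool.≟ true) →-dec (u ≟ᴰ v))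

rotations-D₂ : ∀ (v w : Dih 2) → proj₂ v ≡ false → proj₂ w ≡ false → v ≢ one → w ≢ one → v ≡ w
rotations-D₂ = from-yes (∀-Dih? {2} λ v → ∀-Dih? {2} λ w →
                 (proj₂ v Bool.≟ false) →-dec (proj₂ w Bool.≟ false) →-dec
                 ¬? (v ≟ᴰ one) →-dec ¬? (w ≟ᴰ one) →-dec (v ≟ᴰ w))

match-D₂ : ∀ (u v w : Dih 2) → proj₂ u ≡ true → proj₂ v ≡ true → proj₂ w ≡ false → u ≢ v → w ≢ one →
           AffineMatch 2 u v w x-D2
match-D₂ = from-yes (∀-Dih? {2} λ u → ∀-Dih? {2} λ v → ∀-Dih? {2} λ w →
             (proj₂ u Bool.≟ true) →-dec (proj₂ v Bool.≟ true) →-dec (proj₂ w Bool.≟ false) →-dec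
             ¬? (u ≟ᴰ v) →-dec ¬? (w ≟ᴰ one) →-dec affineMatch? 2 u v w x-D2)

match-D₃ : ∀ (u v w : Dih 3) → proj₂ u ≡ true → proj₂ v ≡ true → proj₂ w ≡ true → u ≢ v → v ≢ w → u ≢ w →
           AffineMatch 3 u v w x-D3
match-D₃ = from-yes (∀-Dih? {3} λ u → ∀-Dih? {3} λ v → ∀-Dih? {3} λ w →
             (proj₂ u Bool.≟ true) →-dec (proj₂ v Bool.≟ true) →-dec (proj₂ w Bool.≟ true) →-dec
             ¬? (u ≟ᴰ v) →-dec ¬? (v ≟ᴰ w) →-dec ¬? (u ≟ᴰ w) →-dec affineMatch? 3 u v w x-D3)

match-D₄ : ∀ (u v : Dih 4) → proj₂ u ≡ true → proj₂ v ≡ false → v ≢ one → v ≢ inv v → AffineMatch 4 u v (inv v) x-D4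
match-D₄ = from-yes (∀-Dih? {4} λ u → ∀-Dih? {4} λ v →
             (proj₂ u Bool.≟ true) →-dec (proj₂ v Bool.≟ false) →-dec
             ¬? (v ≟ᴰ one) →-dec ¬? (v ≟ᴰ inv v) →-dec affineMatch? 4 u v (inv v) x-D4)

3∤4 : ¬ 3 ℕ.∣ 4
3∤4 = from-no (3 ℕ.∣? 4)

2∤3 : ¬ 2 ℕ.∣ 3
2∤3 = from-no (2 ℕ.∣? 3)

two-reflections⇒≅D₂ : ∀ n .{{_ : NonZero n}} (x : Fin 3 → Dih n) → IsCayley3 n x → ∀ k → proj₂ (x k) ≡ false →
                 proj₂ (x (next k)) ≡ true → proj₂ (x (next (next k))) ≡ true → n ℕ.∣ 2 → MapIso n x 2 x-D2
two-reflections⇒≅D₂ 1 x C k e₀ e₁ e₂ _ = ⊥-elim (IsCayley3.nonId C k (rotation-D₁ (x k) e₀))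
two-reflections⇒≅D₂ 2 x C k e₀ e₁ e₂ _ = affine-match-iso 2 (next k)
  (subst (λ w → AffineMatch 2 (x (next k)) (x (next (next k))) w x-D2) (cong x (sym (next³ k)))
    (match-D₂ _ _ _ e₁ e₂ e₀ (λ eq → next≢next² k (IsCayley3.distinct C _ _ eq)) (IsCayley3.nonId C k)))
two-reflections⇒≅D₂ (suc (suc (suc n))) x C k e₀ e₁ e₂ n∣2 = ⊥-elim (ℕ.>⇒∤ (ℕ.s≤s (ℕ.s≤s (ℕ.s≤s ℕ.z≤n))) n∣2)

three-reflections⇒≅D₃ : ∀ n .{{_ : NonZero n}} (x : Fin 3 → Dih n) → IsCayley3 n x → (∀ k → proj₂ (x k) ≡ true) →
                        n ℕ.∣ 3 → MapIso n x 3 x-D3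
three-reflections⇒≅D₃ 1 x C e _ with IsCayley3.distinct C f0 (fs f0) (reflections-D₁ _ _ (e f0) (e (fs f0)))
... | ()
three-reflections⇒≅D₃ 2 x C e 2∣3 = ⊥-elim (2∤3 2∣3)
three-reflections⇒≅D₃ 3 x C e _ = affine-match-iso 3 f0 (match-D₃ _ _ _ (e f0) (e (fs f0)) (e (fs (fs f0)))
  (distinct-indices λ ()) (distinct-indices λ ()) (distinct-indices λ ()))
  where
  distinct-indices : ∀ {i j} → i ≢ j → x i ≢ x j
  distinct-indices i≢j xi≡xj = i≢j (IsCayley3.distinct C _ _ xi≡xj)
three-reflections⇒≅D₃ (suc (suc (suc (suc n)))) x C e n∣3 = ⊥-elim (ℕ.>⇒∤ (ℕ.s≤s (ℕ.s≤s (ℕ.s≤s (ℕ.s≤s ℕ.z≤n)))) n∣3)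

one-reflection⇒≅D₄ : ∀ n .{{_ : NonZero n}} (x : Fin 3 → Dih n) → IsCayley3 n x → ∀ k → proj₂ (x k) ≡ true →
                 proj₂ (x (next k)) ≡ false → proj₂ (x (next (next k))) ≡ false →
                 n ℕ.∣ 2 ⊎ (n ℕ.∣ 4 × x (next (next k)) ≡ inv (x (next k))) → MapIso n x 4 x-D4
one-reflection⇒≅D₄ 1 x C k e₀ e₁ e₂ _ = ⊥-elim (IsCayley3.nonId C (next k) (rotation-D₁ _ e₁))
one-reflection⇒≅D₄ 2 x C k e₀ e₁ e₂ _ = ⊥-elim (next≢next² k (IsCayley3.distinct C _ _
  (rotations-D₂ _ _ e₁ e₂ (IsCayley3.nonId C (next k)) (IsCayley3.nonId C (next (next k))))))
one-reflection⇒≅D₄ 3 x C k e₀ e₁ e₂ (inj₁ 3∣2) = ⊥-elim (ℕ.>⇒∤ (ℕ.s≤s (ℕ.s≤s (ℕ.s≤s ℕ.z≤n))) 3∣2)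
one-reflection⇒≅D₄ 3 x C k e₀ e₁ e₂ (inj₂ (3∣4 , _)) = ⊥-elim (3∤4 3∣4)
one-reflection⇒≅D₄ 4 x C k e₀ e₁ e₂ (inj₁ 4∣2) = ⊥-elim (ℕ.>⇒∤ (ℕ.s≤s (ℕ.s≤s (ℕ.s≤s ℕ.z≤n))) 4∣2)
one-reflection⇒≅D₄ 4 x C k e₀ e₁ e₂ (inj₂ (_ , x₂≡x₁⁻¹)) = affine-match-iso 4 k
  (subst (λ w → AffineMatch 4 (x k) (x (next k)) w x-D4) (sym x₂≡x₁⁻¹)
    (match-D₄ _ _ e₀ e₁ (IsCayley3.nonId C (next k))
      (λ x₁≡x₁⁻¹ → next≢next² k (IsCayley3.distinct C _ _ (trans x₁≡x₁⁻¹ (sym x₂≡x₁⁻¹))))))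
one-reflection⇒≅D₄ (suc (suc (suc (suc (suc n))))) x C k e₀ e₁ e₂ (inj₁ n∣2) =
  ⊥-elim (ℕ.>⇒∤ (ℕ.s≤s (ℕ.s≤s (ℕ.s≤s ℕ.z≤n))) n∣2)
one-reflection⇒≅D₄ (suc (suc (suc (suc (suc n))))) x C k e₀ e₁ e₂ (inj₂ (n∣4 , _)) =
  ⊥-elim (ℕ.>⇒∤ (ℕ.s≤s (ℕ.s≤s (ℕ.s≤s (ℕ.s≤s (ℕ.s≤s ℕ.z≤n))))) n∣4)

module _ {m : ℕ} .{{_ : NonZero m}} (y : Fin 3 → Dih m)
         (distinct : ∀ i j → y i ≡ y j → i ≡ j) (invClosed : ∀ i → ∃ λ j → y j ≡ inv (y i)) where
  open Darts y distinct invClosed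

  RotatesAroundOne : (Dart m → Dart m) → Set
  RotatesAroundOne f = (∀ d → f (f (f d)) ≡ d) × (∀ d → f (rot d) ≡ rot (f d)) ×
                       (∀ d → f (L d) ≡ L (f d)) × (∀ k → f (one , k) ≡ (one , next k))

  ReflectsAroundOne : (Dart m → Dart m) → Set
  ReflectsAroundOne f = (∀ d → f (f d) ≡ d) × (∀ d → f (rot d) ≡ rot (rot (f d))) × (∀ d → f (L d) ≡ L (f d))

  rotatesAroundOne? : ∀ f → Dec (RotatesAroundOne f)
  rotatesAroundOne? f = ∀-Dart? (λ d → f (f (f d)) ≟ᵈ d) ×-dec ∀-Dart? (λ d → f (rot d) ≟ᵈ rot (f d)) ×-dec
                        ∀-Dart? (λ d → f (L d) ≟ᵈ L (f d)) ×-dec Fin.all? (λ k → f (one , k) ≟ᵈ (one , next k))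

  reflectsAroundOne? : ∀ f → Dec (ReflectsAroundOne f)
  reflectsAroundOne? f = ∀-Dart? (λ d → f (f d) ≟ᵈ d) ×-dec ∀-Dart? (λ d → f (rot d) ≟ᵈ rot (rot (f d))) ×-dec
                         ∀-Dart? (λ d → f (L d) ≟ᵈ L (f d))

  private
    commutes-with-L⇒preserves-Lrel : ∀ f → (∀ d → f (L d) ≡ L (f d)) → ∀ d d′ → Lrel m y d d′ → Lrel m y (f d) (f d′)
    commutes-with-L⇒preserves-Lrel f f-L d d′ r = subst (Lrel m y (f d)) (sym (trans (cong f (Lrel⇒≡L r)) (f-L d))) (Lrel-L (f d))

  reflexibleRegular-by : ∀ ρ r → RotatesAroundOne ρ → ReflectsAroundOne r → ReflexibleRegular m y
  reflexibleRegular-by ρ r (ρ³ , ρ-rot , ρ-L , ρ-one) (r² , r-rot , r-L) =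
    regular-from-rotation (mkMapIso ρ (λ d → ρ (ρ d)) ρ³ ρ³ ρ-rot (commutes-with-L⇒preserves-Lrel ρ ρ-L)) ρ-one ,
    mkAutRev r r r² r² r-rot (commutes-with-L⇒preserves-Lrel r r-L)

distinct? : ∀ {m} (y : Fin 3 → Dih m) → Dec (∀ i j → y i ≡ y j → i ≡ j)
distinct? y = Fin.all? λ i → Fin.all? λ j → (y i ≟ᴰ y j) →-dec (i Fin.≟ j)

invClosed? : ∀ {m} .{{_ : NonZero m}} (y : Fin 3 → Dih m) → Dec (∀ i → ∃ λ j → y j ≡ inv (y i))
invClosed? y = Fin.all? λ i → Fin.any? λ j → y j ≟ᴰ inv (y i)

distinct-D₂ : ∀ i j → x-D2 i ≡ x-D2 j → i ≡ j
distinct-D₂ = from-yes (distinct? x-D2)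

invClosed-D₂ : ∀ i → ∃ λ j → x-D2 j ≡ inv (x-D2 i)
invClosed-D₂ = from-yes (invClosed? x-D2)

-- D₂ is the Klein four-group, so cycling its three involutions b ↦ ab ↦ a ↦ b is an automorphism.
ψ₂ : Dih 2 → Dih 2
ψ₂ (f0 , false)    = (f0 , false)
ψ₂ (fs f0 , false) = (f0 , true)
ψ₂ (f0 , true)     = (fs f0 , true)
ψ₂ (fs f0 , true)  = (fs f0 , false)

reflexibleRegular-D₂ : ReflexibleRegular 2 x-D2
reflexibleRegular-D₂ = reflexibleRegular-by x-D2 distinct-D₂ invClosed-D₂ ρ r
  (from-yes (rotatesAroundOne? x-D2 distinct-D₂ invClosed-D₂ ρ)) (from-yes (reflectsAroundOne? x-D2 distinct-D₂ invClosed-D₂ r))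
  where
  ρ r : Dart 2 → Dart 2
  ρ (g , k) = (ψ₂ g , next k)
  r (g , k) = (Affine.affine 2 1 1 g , next (-₃ k))

distinct-D₃ : ∀ i j → x-D3 i ≡ x-D3 j → i ≡ j
distinct-D₃ = from-yes (distinct? x-D3)

invClosed-D₃ : ∀ i → ∃ λ j → x-D3 j ≡ inv (x-D3 i)
invClosed-D₃ = from-yes (invClosed? x-D3)

reflexibleRegular-D₃ : ReflexibleRegular 3 x-D3
reflexibleRegular-D₃ = reflexibleRegular-by x-D3 distinct-D₃ invClosed-D₃ ρ r
  (from-yes (rotatesAroundOne? x-D3 distinct-D₃ invClosed-D₃ ρ)) (from-yes (reflectsAroundOne? x-D3 distinct-D₃ invClosed-D₃ r))
  where
  ρ r : Dart 3 → Dart 3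
  ρ (g , k) = (Affine.affine 3 1 1 g , next k)
  r (g , k) = (Affine.affine 3 2 0 g , -₃ k)

distinct-D₄ : ∀ i j → x-D4 i ≡ x-D4 j → i ≡ j
distinct-D₄ = from-yes (distinct? x-D4)

invClosed-D₄ : ∀ i → ∃ λ j → x-D4 j ≡ inv (x-D4 i)
invClosed-D₄ = from-yes (invClosed? x-D4)

-- The rotation of CM(D₄, {b, a, a⁻¹}) about 1 is not induced by a group automorphism (it would have to send the
-- involution b to a): it is the skew morphism ψ₄ with power function π₄.
ψ₄ : Dih 4 → Dih 4
ψ₄ (f0 , false)                = (f0 , false)
ψ₄ (fs f0 , false)             = (fs (fs (fs f0)) , false)
ψ₄ (fs (fs f0) , false)        = (fs (fs (fs f0)) , true)
ψ₄ (fs (fs (fs f0)) , false)   = (f0 , true)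
ψ₄ (f0 , true)                 = (fs f0 , false)
ψ₄ (fs f0 , true)              = (fs (fs f0) , false)
ψ₄ (fs (fs f0) , true)         = (fs (fs f0) , true)
ψ₄ (fs (fs (fs f0)) , true)    = (fs f0 , true)

π₄ : Dih 4 → Fin 3
π₄ (f0 , false)                = fs f0
π₄ (fs f0 , false)             = fs (fs f0)
π₄ (fs (fs f0) , false)        = fs f0
π₄ (fs (fs (fs f0)) , false)   = fs (fs f0)
π₄ (f0 , true)                 = fs (fs f0)
π₄ (fs f0 , true)              = fs f0
π₄ (fs (fs f0) , true)         = fs (fs f0)
π₄ (fs (fs (fs f0)) , true)    = fs f0

reflexibleRegular-D₄ : ReflexibleRegular 4 x-D4
reflexibleRegular-D₄ = reflexibleRegular-by x-D4 distinct-D₄ invClosed-D₄ ρ r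
  (from-yes (rotatesAroundOne? x-D4 distinct-D₄ invClosed-D₄ ρ)) (from-yes (reflectsAroundOne? x-D4 distinct-D₄ invClosed-D₄ r))
  where
  ρ r : Dart 4 → Dart 4
  ρ (g , k) = (ψ₄ g , k +₃ π₄ g)
  r (g , k) = (Affine.affine 4 3 0 g , -₃ k)

lemma4p1 : (n : ℕ) .{{_ : NonZero n}} (x : Fin 3 → Dih n) → IsCayley3 n x →
           ReflexibleRegular n x ⇔
             (MapIso n x 2 x-D2 ⊎ MapIso n x 3 x-D3 ⊎ MapIso n x 4 x-D4)
lemma4p1 n x C = mk⇔ classify exceptional
  where
  open IsCayley3 C
  open Classification n x C using (one-reflection⇒∣2⊎∣4; two-reflections⇒∣2; three-reflections⇒∣3)
  classify : ReflexibleRegular n x → MapIso n x 2 x-D2 ⊎ MapIso n x 3 x-D3 ⊎ MapIso n x 4 x-D4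
  classify (regular , ψ) with reflectionPattern (λ k → proj₂ (x k))
  ... | none e = ⊥-elim (Generation.some-reflection n x C e)
  ... | exactlyOne k e₀ e₁ e₂ =
    inj₂ (inj₂ (one-reflection⇒≅D₄ n x C k e₀ e₁ e₂ (one-reflection⇒∣2⊎∣4 regular k e₀ e₁ e₂)))
  ... | exactlyTwo k e₀ e₁ e₂ =
    inj₁ (two-reflections⇒≅D₂ n x C k e₀ e₁ e₂ (two-reflections⇒∣2 regular k e₀ e₁ e₂))
  ... | allThree e =
    inj₂ (inj₁ (three-reflections⇒≅D₃ n x C e (three-reflections⇒∣3 (regular , ψ) e)))
  exceptional : MapIso n x 2 x-D2 ⊎ MapIso n x 3 x-D3 ⊎ MapIso n x 4 x-D4 → ReflexibleRegular n x
  exceptional (inj₁ α)        = reflexibleRegular-transport distinct invClosed distinct-D₂ invClosed-D₂ α reflexibleRegular-D₂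
  exceptional (inj₂ (inj₁ α)) = reflexibleRegular-transport distinct invClosed distinct-D₃ invClosed-D₃ α reflexibleRegular-D₃
  exceptional (inj₂ (inj₂ α)) = reflexibleRegular-transport distinct invClosed distinct-D₄ invClosed-D₄ α reflexibleRegular-D₄
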